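{- Let $G$ be a finite abstract simplicial complex, $K\subseteq G$ a subcomplex and $U=G\setminus K$, and let $\Lambda$ be any one of the sets $\Lambda(G)=\{(x,y)\in G\times G: x\cap y\neq\emptyset\}$, $\Lambda(K)=\{(x,y)\in K\times K: x\cap y\neq\emptyset\}$, $\Lambda(U)=\{(x,y)\in U\times U: x\cap y\in U\}$, $\Lambda(K,U)=\{(x,y)\in K\times U: x\cap y\neq\emptyset\}$, $\Lambda(U,K)=\{(x,y)\in U\times K: x\cap y\neq\emptyset\}$, $\Lambda(U,U)=\{(x,y)\in U\times U: x\cap y\in K\}$. Then the Euler–Poincaré formula holds: $\sum_{k}(-1)^k f_k(\Lambda)=\sum_k(-1)^k b_k(\Lambda)$.
   Context: A finite abstract simplicial complex $G$ is a finite set of nonempty finite sets (simplices) closed under taking nonempty subsets; $\dim(x)=|x|-1$. A subcomplex $K\subseteq G$ is a subset itself closed under taking nonempty subsets; $U=G\setminus K$. Fix a total order on the vertices; write $x=(v_0,\dots,v_p)$ with increasing vertices and $x^{(i)}=x\setminus\{v_i\}$. For a finite set $\Lambda$ of ordered pairs of simplices, define $d_\Lambda$ on real functions on $\Lambda$ by $(d_\Lambda f)(x,y)=\sum_{i=0}^{\dim x}(-1)^i f(x^{(i)},y)+(-1)^{\dim x}\sum_{j=0}^{\dim y}(-1)^j f(x,y^{(j)})$, omitting terms whose argument is not a pair in $\Lambda$. As matrices indexed by $\Lambda$, $D_\Lambda=d_\Lambda+d_\Lambda^T$ and $L_\Lambda=D_\Lambda^2$. A pair $(x,y)$ is a $k$-pair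 if $\dim x+\dim y=k$; $f_k(\Lambda)$ is the number of $k$-pairs in $\Lambda$, and $b_k(\Lambda)$ is the dimension of the kernel of the diagonal block of $L_\Lambda$ indexed by the $k$-pairs of $\Lambda$. -}

module Defs where

open import Data.Bool.Base using (Bool; true; false; _∧_; not)
open import Data.Nat.Base using (ℕ; zero; suc; _+_; _∸_; _<ᵇ_; _≡ᵇ_)
open import Data.Fin.Base using (Fin; toℕ)
open import Data.Fin.Subset using (Subset; _∈_; _⊆_; _∩_; _-_; ∣_∣; Nonempty; inside; outside)
open import Data.Fin.Subset.Properties using (_∈?_; nonempty?)
open import Data.List.Base using (List; []; _∷_; [_]; _++_; map; foldr; length; filterᵇ; allFin; cartesianProduct; lookup)
open import Data.Vec.Base using (Vec) renaming ([] to []ᵥ; _∷_ to _∷ᵥ_)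
open import Data.Vec.Properties using (≡-dec)
open import Data.Bool.Properties renaming (_≟_ to _≟ᵇ_)
open import Data.Product.Base using (Σ; _×_; _,_)
open import Data.Integer.Base as ℤ using (ℤ; +_)
open import Data.Rational.Base using (ℚ; 0ℚ; 1ℚ; -_) renaming (_+_ to _+ℚ_; _*_ to _*ℚ_)
open import Relation.Nullary.Decidable.Core using (does)
open import Relation.Binary.PropositionalEquality using (_≡_)

-- Vertices are Fin n (ordered by the usual order of Fin n);
-- simplices are subsets of Fin n.

IsComplex : {n : ℕ} → (Subset n → Bool) → Set
IsComplex {n} G =
  ((x : Subset n) → G x ≡ true → Nonempty x) ×
  ((x y : Subset n) → G x ≡ true → y ⊆ x → Nonempty y → G y ≡ true)

IsSubcomplex : {n : ℕ} → (Subset n → Bool) → (Subset n → Bool) → Set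
IsSubcomplex {n} K G =
  ((x : Subset n) → K x ≡ true → G x ≡ true) × IsComplex K

diffC : {n : ℕ} → (Subset n → Bool) → (Subset n → Bool) → Subset n → Bool
diffC G K x = G x ∧ not (K x)

allSubsets : (n : ℕ) → List (Subset n)
allSubsets zero = [ []ᵥ ]
allSubsets (suc n) = map (outside ∷ᵥ_) (allSubsets n) ++ map (inside ∷ᵥ_) (allSubsets n)

Pair : ℕ → Set
Pair n = Subset n × Subset n

allPairs : (n : ℕ) → List (Pair n)
allPairs n = cartesianProduct (allSubsets n) (allSubsets n)

eqS : {n : ℕ} → Subset n → Subset n → Bool
eqS x y = does (≡-dec _≟ᵇ_ x y)

nonemptyᵇ : {n : ℕ} → Subset n → Bool
nonemptyᵇ x = does (nonempty? x)

data LambdaKind : Set where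
  ΛG ΛK ΛU ΛKU ΛUK ΛUU : LambdaKind

inΛ : {n : ℕ} → (G K : Subset n → Bool) → LambdaKind → Pair n → Bool
inΛ G K ΛG  (x , y) = G x ∧ G y ∧ nonemptyᵇ (x ∩ y)
inΛ G K ΛK  (x , y) = K x ∧ K y ∧ nonemptyᵇ (x ∩ y)
inΛ G K ΛU  (x , y) = diffC G K x ∧ diffC G K y ∧ diffC G K (x ∩ y)
inΛ G K ΛKU (x , y) = K x ∧ diffC G K y ∧ nonemptyᵇ (x ∩ y)
inΛ G K ΛUK (x , y) = diffC G K x ∧ K y ∧ nonemptyᵇ (x ∩ y)
inΛ G K ΛUU (x , y) = diffC G K x ∧ diffC G K y ∧ K (x ∩ y)

-- Λ as a (duplicate-free) list of pairs
Λ : {n : ℕ} → (G K : Subset n → Bool) → LambdaKind → List (Pair n)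
Λ {n} G K κ = filterᵇ (inΛ G K κ) (allPairs n)

sumℚ : List ℚ → ℚ
sumℚ = foldr _+ℚ_ 0ℚ

sgn : ℕ → ℚ
sgn zero = 1ℚ
sgn (suc k) = - sgn k

dim : {n : ℕ} → Subset n → ℕ
dim x = ∣ x ∣ ∸ 1

-- position i of vertex v in x = (v_0,...,v_p): number of vertices of x below v
pos : {n : ℕ} → Subset n → Fin n → ℕ
pos {n} x v = length (filterᵇ (λ u → does (u ∈? x) ∧ (toℕ u <ᵇ toℕ v)) (allFin n))

ifᵇ : Bool → ℚ → ℚ
ifᵇ true q = q
ifᵇ false q = 0ℚ

-- coefficient of f(x',y') in (d_Λ f)(x,y); (x',y') ranges over Λ so only
-- terms whose argument is a pair of Λ occur.
dcoef : {n : ℕ} → Pair n → Pair n → ℚ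
dcoef {n} (x , y) (x' , y') =
  sumℚ (map (λ v → ifᵇ (does (v ∈? x) ∧ eqS (x - v) x' ∧ eqS y y') (sgn (pos x v))) (allFin n))
  +ℚ (sgn (dim x) *ℚ
      sumℚ (map (λ w → ifᵇ (does (w ∈? y) ∧ eqS x x' ∧ eqS (y - w) y') (sgn (pos y w))) (allFin n)))

Dcoef : {n : ℕ} → Pair n → Pair n → ℚ
Dcoef p q = dcoef p q +ℚ dcoef q p

Lcoef : {n : ℕ} → List (Pair n) → Pair n → Pair n → ℚ
Lcoef Λs p q = sumℚ (map (λ r → Dcoef p r *ℚ Dcoef r q) Λs)

isKpair : {n : ℕ} → ℕ → Pair n → Bool
isKpair k (x , y) = (dim x + dim y) ≡ᵇ k

kPairs : {n : ℕ} → List (Pair n) → ℕ → List (Pair n)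
kPairs Λs k = filterᵇ (isKpair k) Λs

fk : {n : ℕ} → List (Pair n) → ℕ → ℕ
fk Λs k = length (kPairs Λs k)

Lblock : {n : ℕ} → (Λs : List (Pair n)) → (k : ℕ) → Fin (fk Λs k) → Fin (fk Λs k) → ℚ
Lblock Λs k i j = Lcoef Λs (lookup (kPairs Λs k) i) (lookup (kPairs Λs k) j)

sumFin : {m : ℕ} → (Fin m → ℚ) → ℚ
sumFin {m} f = sumℚ (map f (allFin m))

_*ᵥ_ : {m : ℕ} → (Fin m → Fin m → ℚ) → (Fin m → ℚ) → Fin m → ℚ
(M *ᵥ v) i = sumFin (λ j → M i j *ℚ v j)

InKernel : {m : ℕ} → (Fin m → Fin m → ℚ) → (Fin m → ℚ) → Set
InKernel M v = ∀ i → (M *ᵥ v) i ≡ 0ℚ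

IsKerDim : {m : ℕ} → (Fin m → Fin m → ℚ) → ℕ → Set
IsKerDim {m} M r =
  Σ (Fin r → Fin m → ℚ) λ B →
    ((i : Fin r) → InKernel M (B i)) ×
    ((c : Fin r → ℚ) → ((j : Fin m) → sumFin (λ i → c i *ℚ B i j) ≡ 0ℚ) → (i : Fin r) → c i ≡ 0ℚ) ×
    ((v : Fin m → ℚ) → InKernel M v →
       Σ (Fin r → ℚ) λ c → (j : Fin m) → v j ≡ sumFin (λ i → c i *ℚ B i j))

sgnℤ : ℕ → ℤ
sgnℤ zero = + 1
sgnℤ (suc k) = ℤ.- sgnℤ k

altSum : ℕ → (ℕ → ℕ) → ℤ
altSum zero a = + 0
altSum (suc N) a = altSum N a ℤ.+ (sgnℤ N ℤ.* (+ a N))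

{-# OPTIONS --safe #-}
-- Let d be the coboundary on pairs of simplices, (d f)(x , y) = f(∂x , y) ± f(x , ∂y). A pair lying
-- between two pairs of Λ again belongs to Λ, so d restricted to Λ is still a differential, and the
-- diagonal blocks of L = (d + dᵀ)² are the Hodge Laplacians dᵀd + d dᵀ of the cochain complex of
-- k-pairs. The kernel of the k-th Laplacian is the orthogonal complement of im d ⊕ im dᵀ in degree k,
-- and row rank equals column rank, so f_k = r_{k-1} + r_k + b_k with r_k the rank of d in degree k:
-- the alternating sum of the f_k minus that of the b_k telescopes to zero.

module Submission where

open import Algebra.Properties.Group using (∙-cancelˡ; ⁻¹-selfInverse)
open import Data.Bool.Base using (Bool; true; false; _∧_; not; T)
open import Data.Bool.Properties using (∧-zeroʳ; T-∧; T-≡) renaming (_≟_ to _≟ᵇ_)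
open import Data.Empty using (⊥-elim)
open import Data.Fin.Base using (Fin; zero; suc; toℕ; _↑ˡ_; _↑ʳ_; splitAt) renaming (_<_ to _<ᶠ_)
open import Data.Fin.Properties using (suc-injective; join-splitAt) renaming (<-cmp to <ᶠ-cmp; _≟_ to _≟ᶠ_)
open import Data.Fin.Subset using (Subset; _∈_; _∉_; _⊆_; _∩_; ∣_∣; ⁅_⁆; Nonempty; inside; outside)
  renaming (_-_ to _∖_)
open import Data.Fin.Subset.Properties
  using (_∈?_; nonempty?; ∣p∣≤n; x∈p∩q⁺; x∈p∩q⁻; p─⊥≡p; p─q⊆p; x∈p∧x≢y⇒x∈p-y; p─x─y≡p─y─x)
open import Data.List.Base
  using (List; []; _∷_; map; _++_; allFin; cartesianProduct; lookup; length; filterᵇ; tabulate)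
open import Data.List.Membership.Propositional.Properties using (∈-filter⁻; ∈-lookup)
open import Data.List.Properties using (map-tabulate; filter-none)
import Data.List.Relation.Unary.All as All
import Data.Nat.Base as ℕ
open ℕ using (ℕ)
import Data.Nat.Properties as ℕₚ
open ℕₚ using (≡ᵇ⇒≡)
open import Data.Product.Base using (Σ; _×_; _,_; proj₁; proj₂)
open import Data.Sum.Base using (_⊎_; inj₁; inj₂; [_,_]′; reduce)
open import Data.Vec.Base using ([]; _∷_; here; there)
open import Data.Vec.Functional using (Vector) renaming (_∷_ to _∷ᶠ_; _++_ to _++ᶠ_)
open import Data.Vec.Functional.Properties using (lookup-++ˡ; lookup-++ʳ)
open import Data.Vec.Properties using (≡-dec; ∷-injectiveʳ)
open import Function.Base using (_∘_; _$_; id)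
open import Function.Bundles using (mk⇔; _⇔_; Equivalence)
open import Level using (0ℓ)
open import Relation.Binary.Definitions using (tri<; tri≈; tri>)
open import Relation.Binary.PropositionalEquality
  using (_≡_; _≢_; refl; sym; trans; cong; cong₂; subst₂; _≗_; module ≡-Reasoning)
open import Relation.Nullary using (¬_; Dec; yes; no)
open import Relation.Nullary.Decidable using (dec-true; dec-false; does-⇔)
open import Relation.Nullary.Decidable.Core using (does; dec⇒maybe; T?)
open import Tactic.RingSolver.Core.AlmostCommutativeRing using (AlmostCommutativeRing; fromCommutativeRing)

open import Defs

module AlternatingSum where

  open import Data.Integer.Base using (+_; _+_; _*_; -_; _-_)
  open import Data.Integer.Properties using (pos-+)
  open import Data.Integer.Tactic.RingSolver using (solve-∀)

  altSum-telescope : (g b f : ℕ → ℕ) → (∀ k → f k ≡ g k ℕ.+ (g (ℕ.suc k) ℕ.+ b k)) →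
    ∀ M → altSum M f ≡ altSum M b + (+ g 0 - sgnℤ M * + g M)
  altSum-telescope g b f f≡ ℕ.zero    = sym (solve (+ g 0))
    where
    solve : ∀ x → + 0 + (x - + 1 * x) ≡ + 0
    solve = solve-∀
  altSum-telescope g b f f≡ (ℕ.suc M) = begin
    altSum M f + s * + f M
      ≡⟨ cong₂ (λ x y → x + s * y) (altSum-telescope g b f f≡ M) (cong +_ (f≡ M)) ⟩
    (altSum M b + (+ g 0 - s * + g M)) + s * + (g M ℕ.+ (g (ℕ.suc M) ℕ.+ b M))
      ≡⟨ cong (λ x → (altSum M b + (+ g 0 - s * + g M)) + s * x)
              (trans (pos-+ (g M) _) (cong (λ x → + g M + x) (pos-+ (g (ℕ.suc M)) (b M)))) ⟩
    (altSum M b + (+ g 0 - s * + g M)) + s * (+ g M + (+ g (ℕ.suc M) + + b M))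
      ≡⟨ solve (altSum M b) (+ g 0) s (+ g M) (+ g (ℕ.suc M)) (+ b M) ⟩
    (altSum M b + s * + b M) + (+ g 0 - (- s) * + g (ℕ.suc M))
      ∎
    where
    open ≡-Reasoning
    s = sgnℤ M
    solve : ∀ A g₀ s x y z → (A + (g₀ - s * x)) + s * (x + (y + z)) ≡ (A + s * z) + (g₀ - (- s) * y)
    solve = solve-∀

  altSum-telescope-vanishing : (g b f : ℕ → ℕ) → (∀ k → f k ≡ g k ℕ.+ (g (ℕ.suc k) ℕ.+ b k)) →
    ∀ M → g 0 ≡ 0 → g M ≡ 0 → altSum M f ≡ altSum M b
  altSum-telescope-vanishing g b f f≡ M g₀≡0 gM≡0 = begin
    altSum M f                                 ≡⟨ altSum-telescope g b f f≡ M ⟩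
    altSum M b + (+ g 0 - sgnℤ M * + g M)      ≡⟨ cong₂ (λ x y → altSum M b + (+ x - sgnℤ M * + y)) g₀≡0 gM≡0 ⟩
    altSum M b + (+ 0 - sgnℤ M * + 0)          ≡⟨ solve (altSum M b) (sgnℤ M) ⟩
    altSum M b                                 ∎
    where
    open ≡-Reasoning
    solve : ∀ A s → A + (+ 0 - s * + 0) ≡ A
    solve = solve-∀

open AlternatingSum using (altSum-telescope-vanishing)

open import Data.Rational.Base
  using (ℚ; 0ℚ; 1ℚ; _+_; _*_; -_; _-_; 1/_; _≤_; _<_; ≢-nonZero; nonNegative; nonPositive)
open import Data.Rational.Properties
  using ( _≟_; +-*-commutativeRing; +-0-group
        ; +-identityˡ; +-identityʳ; +-assoc; +-comm; +-inverseʳ; neg-distrib-+; neg-distribˡ-*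
        ; *-zeroˡ; *-zeroʳ; *-identityˡ; *-identityʳ; *-assoc; *-comm; *-distribˡ-+; *-distribʳ-+; *-inverseˡ
        ; ≤-refl; ≤-total; ≤-antisym; <-irrefl; <-≤-trans; +-mono-≤; +-monoʳ-≤
        ; positive⁻¹; nonNegative⁻¹; nonNeg*nonNeg⇒nonNeg; nonPos*nonPos⇒nonPos )
open import Tactic.RingSolver using (solve-∀)

ℚ-ring : AlmostCommutativeRing 0ℓ 0ℓ
ℚ-ring = fromCommutativeRing +-*-commutativeRing (λ x → dec⇒maybe (0ℚ ≟ x))

p*q≡0⇒p≡0⊎q≡0 : ∀ p q → p * q ≡ 0ℚ → p ≡ 0ℚ ⊎ q ≡ 0ℚ
p*q≡0⇒p≡0⊎q≡0 p q pq≡0 with p ≟ 0ℚ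
... | yes p≡0 = inj₁ p≡0
... | no  p≢0 = inj₂ (begin
  q                ≡⟨ sym (*-identityˡ q) ⟩
  1ℚ * q           ≡⟨ cong (_* q) (sym (*-inverseˡ p)) ⟩
  (1/ p * p) * q   ≡⟨ *-assoc (1/ p) p q ⟩
  1/ p * (p * q)   ≡⟨ cong (1/ p *_) pq≡0 ⟩
  1/ p * 0ℚ        ≡⟨ *-zeroʳ (1/ p) ⟩
  0ℚ               ∎)
  where
  open ≡-Reasoning
  instance _ = ≢-nonZero p≢0

p*p≡0⇒p≡0 : ∀ p → p * p ≡ 0ℚ → p ≡ 0ℚ
p*p≡0⇒p≡0 p pp≡0 = reduce (p*q≡0⇒p≡0⊎q≡0 p p pp≡0)

p+p≡0⇒p≡0 : ∀ p → p + p ≡ 0ℚ → p ≡ 0ℚ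
p+p≡0⇒p≡0 p p+p≡0 = [ (λ ()) , id ]′ (p*q≡0⇒p≡0⊎q≡0 (1ℚ + 1ℚ) p (trans (double p) p+p≡0))
  where
  double : ∀ p → (1ℚ + 1ℚ) * p ≡ p + p
  double = solve-∀ ℚ-ring

p*q≢0⇒p≢0×q≢0 : ∀ p q → p * q ≢ 0ℚ → p ≢ 0ℚ × q ≢ 0ℚ
p*q≢0⇒p≢0×q≢0 p q pq≢0 =
  (λ p≡0 → pq≢0 (trans (cong (_* q) p≡0) (*-zeroˡ q))) , (λ q≡0 → pq≢0 (trans (cong (p *_) q≡0) (*-zeroʳ p)))

0≤p*p : ∀ p → 0ℚ ≤ p * p
0≤p*p p with ≤-total 0ℚ p
... | inj₁ 0≤p = let instance _ = nonNegative 0≤p in nonNegative⁻¹ _ {{nonNeg*nonNeg⇒nonNeg p p}}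
... | inj₂ p≤0 = let instance _ = nonPositive p≤0 in nonNegative⁻¹ _ {{nonPos*nonPos⇒nonPos p p}}
  -- despite its name, nonPos*nonPos⇒nonPos concludes NonNegative

0≤p→0≤q→p+q≡0⇒p≡0 : ∀ {p q} → 0ℚ ≤ p → 0ℚ ≤ q → p + q ≡ 0ℚ → p ≡ 0ℚ
0≤p→0≤q→p+q≡0⇒p≡0 {p} {q} 0≤p 0≤q p+q≡0 = ≤-antisym p≤0 0≤p
  where
  p≤0 : p ≤ 0ℚ
  p≤0 = subst₂ _≤_ (+-identityʳ p) p+q≡0 (+-monoʳ-≤ p 0≤q)

sumMap : {A : Set} → (A → ℚ) → List A → ℚ
sumMap f xs = sumℚ (map f xs)

module _ {A : Set} where

  sumMap-cong : {f g : A → ℚ} (xs : List A) → (∀ a → f a ≡ g a) → sumMap f xs ≡ sumMap g xs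
  sumMap-cong []       f≗g = refl
  sumMap-cong (x ∷ xs) f≗g = cong₂ _+_ (f≗g x) (sumMap-cong xs f≗g)

  sumMap-zero : {f : A → ℚ} (xs : List A) → (∀ a → f a ≡ 0ℚ) → sumMap f xs ≡ 0ℚ
  sumMap-zero []       f≗0 = refl
  sumMap-zero (x ∷ xs) f≗0 = cong₂ _+_ (f≗0 x) (sumMap-zero xs f≗0)

  sumMap-+ : (f g : A → ℚ) (xs : List A) → sumMap (λ a → f a + g a) xs ≡ sumMap f xs + sumMap g xs
  sumMap-+ f g []       = refl
  sumMap-+ f g (x ∷ xs) =
    trans (cong (f x + g x +_) (sumMap-+ f g xs)) (+-interchange (f x) (g x) (sumMap f xs) (sumMap g xs))
    where
    +-interchange : ∀ a b c d → (a + b) + (c + d) ≡ (a + c) + (b + d)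
    +-interchange = solve-∀ ℚ-ring

  sumMap-*ˡ : (c : ℚ) (f : A → ℚ) (xs : List A) → sumMap (λ a → c * f a) xs ≡ c * sumMap f xs
  sumMap-*ˡ c f []       = sym (*-zeroʳ c)
  sumMap-*ˡ c f (x ∷ xs) =
    trans (cong (c * f x +_) (sumMap-*ˡ c f xs)) (sym (*-distribˡ-+ c (f x) (sumMap f xs)))

  sumMap-*ʳ : (c : ℚ) (f : A → ℚ) (xs : List A) → sumMap (λ a → f a * c) xs ≡ sumMap f xs * c
  sumMap-*ʳ c f []       = sym (*-zeroˡ c)
  sumMap-*ʳ c f (x ∷ xs) =
    trans (cong (f x * c +_) (sumMap-*ʳ c f xs)) (sym (*-distribʳ-+ c (f x) (sumMap f xs)))

  sumMap-neg : (f : A → ℚ) (xs : List A) → sumMap (λ a → - f a) xs ≡ - sumMap f xs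
  sumMap-neg f []       = refl
  sumMap-neg f (x ∷ xs) =
    trans (cong (- f x +_) (sumMap-neg f xs)) (sym (neg-distrib-+ (f x) (sumMap f xs)))

  sumMap-++ : (f : A → ℚ) (xs ys : List A) → sumMap f (xs ++ ys) ≡ sumMap f xs + sumMap f ys
  sumMap-++ f []       ys = sym (+-identityˡ _)
  sumMap-++ f (x ∷ xs) ys =
    trans (cong (f x +_) (sumMap-++ f xs ys)) (sym (+-assoc (f x) (sumMap f xs) (sumMap f ys)))

  sumMap-map : {B : Set} (f : B → ℚ) (g : A → B) (xs : List A) → sumMap f (map g xs) ≡ sumMap (f ∘ g) xs
  sumMap-map f g []       = refl
  sumMap-map f g (x ∷ xs) = cong (f (g x) +_) (sumMap-map f g xs)

sumMap-comm : {A B : Set} (f : A → B → ℚ) (xs : List A) (ys : List B) →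
  sumMap (λ a → sumMap (f a) ys) xs ≡ sumMap (λ b → sumMap (λ a → f a b) xs) ys
sumMap-comm f []       ys = sym (sumMap-zero ys (λ _ → refl))
sumMap-comm f (x ∷ xs) ys =
  trans (cong (sumMap (f x) ys +_) (sumMap-comm f xs ys)) (sym (sumMap-+ (f x) (λ b → sumMap (λ a → f a b) xs) ys))

sumMap-cartesianProduct : {A B : Set} (f : A × B → ℚ) (xs : List A) (ys : List B) →
  sumMap f (cartesianProduct xs ys) ≡ sumMap (λ a → sumMap (λ b → f (a , b)) ys) xs
sumMap-cartesianProduct f []       ys = refl
sumMap-cartesianProduct f (x ∷ xs) ys =
  trans (sumMap-++ f (map (x ,_) ys) (cartesianProduct xs ys))
        (cong₂ _+_ (sumMap-map f (x ,_) ys) (sumMap-cartesianProduct f xs ys))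

sumFin-suc : {m : ℕ} (f : Fin (ℕ.suc m) → ℚ) → sumFin f ≡ f zero + sumFin (f ∘ suc)
sumFin-suc f = cong (λ xs → f zero + sumℚ xs)
  (trans (map-tabulate suc f) (sym (map-tabulate id (f ∘ suc))))

sumFin-cong : {m : ℕ} {f g : Fin m → ℚ} → (∀ i → f i ≡ g i) → sumFin f ≡ sumFin g
sumFin-cong = sumMap-cong (allFin _)

sumFin-zero : {m : ℕ} {f : Fin m → ℚ} → (∀ i → f i ≡ 0ℚ) → sumFin f ≡ 0ℚ
sumFin-zero = sumMap-zero (allFin _)

sumFin-+ : {m : ℕ} (f g : Fin m → ℚ) → sumFin (λ i → f i + g i) ≡ sumFin f + sumFin g
sumFin-+ f g = sumMap-+ f g (allFin _)

sumFin-*ˡ : {m : ℕ} (c : ℚ) (f : Fin m → ℚ) → sumFin (λ i → c * f i) ≡ c * sumFin f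
sumFin-*ˡ c f = sumMap-*ˡ c f (allFin _)

sumFin-*ʳ : {m : ℕ} (c : ℚ) (f : Fin m → ℚ) → sumFin (λ i → f i * c) ≡ sumFin f * c
sumFin-*ʳ c f = sumMap-*ʳ c f (allFin _)

sumFin-neg : {m : ℕ} (f : Fin m → ℚ) → sumFin (λ i → - f i) ≡ - sumFin f
sumFin-neg f = sumMap-neg f (allFin _)

sumFin-comm : {m k : ℕ} (f : Fin m → Fin k → ℚ) →
  sumFin (λ i → sumFin (f i)) ≡ sumFin (λ j → sumFin (λ i → f i j))
sumFin-comm f = sumMap-comm f (allFin _) (allFin _)

sumFin-↑ : (a b : ℕ) (f : Fin (a ℕ.+ b) → ℚ) →
  sumFin f ≡ sumFin (λ i → f (i ↑ˡ b)) + sumFin (λ j → f (a ↑ʳ j))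
sumFin-↑ ℕ.zero    b f = sym (+-identityˡ _)
sumFin-↑ (ℕ.suc a) b f = begin
  sumFin f                                          ≡⟨ sumFin-suc f ⟩
  f zero + sumFin (f ∘ suc)                         ≡⟨ cong (f zero +_) (sumFin-↑ a b (f ∘ suc)) ⟩
  f zero + (sumFin (λ i → f (suc (i ↑ˡ b))) + R)    ≡⟨ sym (+-assoc (f zero) _ R) ⟩
  (f zero + sumFin (λ i → f (suc (i ↑ˡ b)))) + R    ≡⟨ cong (_+ R) (sym (sumFin-suc (λ i → f (i ↑ˡ b)))) ⟩
  sumFin (λ i → f (i ↑ˡ b)) + R                     ∎
  where
  open ≡-Reasoning
  R = sumFin (λ j → f (ℕ.suc a ↑ʳ j))

sumFin-single : {m : ℕ} (f : Fin m → ℚ) (i : Fin m) → (∀ j → j ≢ i → f j ≡ 0ℚ) → sumFin f ≡ f i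
sumFin-single f zero    f≡0 = begin
  sumFin f                   ≡⟨ sumFin-suc f ⟩
  f zero + sumFin (f ∘ suc)  ≡⟨ cong (f zero +_) (sumFin-zero (λ j → f≡0 (suc j) (λ ()))) ⟩
  f zero + 0ℚ                ≡⟨ +-identityʳ (f zero) ⟩
  f zero                     ∎
  where open ≡-Reasoning
sumFin-single f (suc i) f≡0 = begin
  sumFin f
    ≡⟨ sumFin-suc f ⟩
  f zero + sumFin (f ∘ suc)
    ≡⟨ cong₂ _+_ (f≡0 zero (λ ())) (sumFin-single (f ∘ suc) i (λ j j≢i → f≡0 (suc j) (j≢i ∘ suc-injective))) ⟩
  0ℚ + f (suc i)
    ≡⟨ +-identityˡ (f (suc i)) ⟩
  f (suc i)
    ∎
  where open ≡-Reasoning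

sumFin-lookup : {A : Set} (f : A → ℚ) (xs : List A) → sumFin (f ∘ lookup xs) ≡ sumMap f xs
sumFin-lookup f []       = refl
sumFin-lookup f (x ∷ xs) = trans (sumFin-suc (f ∘ lookup (x ∷ xs))) (cong (f x +_) (sumFin-lookup f xs))

sumFin-≢0 : {m : ℕ} (f : Fin m → ℚ) → sumFin f ≢ 0ℚ → Σ (Fin m) λ i → f i ≢ 0ℚ
sumFin-≢0 {ℕ.zero}  f sum≢0 = ⊥-elim (sum≢0 refl)
sumFin-≢0 {ℕ.suc m} f sum≢0 with f zero ≟ 0ℚ
... | no  f0≢0 = zero , f0≢0
... | yes f0≡0 =
  let i , fi≢0 = sumFin-≢0 (f ∘ suc) (λ rest≡0 → sum≢0 (trans (sumFin-suc f) (cong₂ _+_ f0≡0 rest≡0)))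
  in suc i , fi≢0

sumFin-antisymmetric : {m : ℕ} (F : Fin m → Fin m → ℚ) → (∀ v u → F v u ≡ - F u v) →
  sumFin (λ v → sumFin (F v)) ≡ 0ℚ
sumFin-antisymmetric F antisym = p+p≡0⇒p≡0 S (trans (cong (S +_) S≡-S) (+-inverseʳ S))
  where
  open ≡-Reasoning
  S = sumFin (λ v → sumFin (F v))
  S≡-S : S ≡ - S
  S≡-S = begin
    S                                       ≡⟨ sumFin-comm F ⟩
    sumFin (λ u → sumFin (λ v → F v u))     ≡⟨ sumFin-cong (λ u → sumFin-cong (λ v → antisym v u)) ⟩
    sumFin (λ u → sumFin (λ v → - F u v))   ≡⟨ sumFin-cong (λ u → sumFin-neg (F u)) ⟩
    sumFin (λ u → - sumFin (F u))           ≡⟨ sumFin-neg (λ u → sumFin (F u)) ⟩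
    - S                                     ∎

sumFin-nonNeg : {m : ℕ} (f : Fin m → ℚ) → (∀ i → 0ℚ ≤ f i) → 0ℚ ≤ sumFin f
sumFin-nonNeg {ℕ.zero}  f 0≤f = ≤-refl
sumFin-nonNeg {ℕ.suc m} f 0≤f = subst₂ _≤_ (+-identityˡ 0ℚ) (sym (sumFin-suc f))
  (+-mono-≤ (0≤f zero) (sumFin-nonNeg (f ∘ suc) (0≤f ∘ suc)))

sumFin-nonNeg≡0 : {m : ℕ} (f : Fin m → ℚ) → (∀ i → 0ℚ ≤ f i) → sumFin f ≡ 0ℚ → ∀ i → f i ≡ 0ℚ
sumFin-nonNeg≡0 f 0≤f sum≡0 zero =
  0≤p→0≤q→p+q≡0⇒p≡0 (0≤f zero) (sumFin-nonNeg (f ∘ suc) (0≤f ∘ suc)) (trans (sym (sumFin-suc f)) sum≡0)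
sumFin-nonNeg≡0 f 0≤f sum≡0 (suc i) = sumFin-nonNeg≡0 (f ∘ suc) (0≤f ∘ suc)
  (0≤p→0≤q→p+q≡0⇒p≡0 (sumFin-nonNeg (f ∘ suc) (0≤f ∘ suc)) (0≤f zero)
    (trans (+-comm _ (f zero)) (trans (sym (sumFin-suc f)) sum≡0))) i

card : ℕ → ℚ
card n = sumFin {n} (λ _ → 1ℚ)

0<card-suc : ∀ n → 0ℚ < card (ℕ.suc n)
0<card-suc n = <-≤-trans (positive⁻¹ 1ℚ) (subst₂ _≤_ (+-identityʳ 1ℚ) (sym (sumFin-suc {n} (λ _ → 1ℚ)))
  (+-monoʳ-≤ 1ℚ (sumFin-nonNeg {n} (λ _ → 1ℚ) (λ _ → nonNegative⁻¹ 1ℚ))))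

card-injective : ∀ a b → card a ≡ card b → a ≡ b
card-injective ℕ.zero    ℕ.zero    _  = refl
card-injective ℕ.zero    (ℕ.suc b) eq = ⊥-elim (<-irrefl eq (0<card-suc b))
card-injective (ℕ.suc a) ℕ.zero    eq = ⊥-elim (<-irrefl (sym eq) (0<card-suc a))
card-injective (ℕ.suc a) (ℕ.suc b) eq = cong ℕ.suc (card-injective a b (∙-cancelˡ +-0-group 1ℚ (card a) (card b)
  (trans (sym (sumFin-suc {a} (λ _ → 1ℚ))) (trans eq (sumFin-suc {b} (λ _ → 1ℚ))))))

T-not⇔¬T : {c : Bool} → T (not c) ⇔ (¬ T c)
T-not⇔¬T {true}  = mk⇔ (λ ()) (λ ¬⊤ → ¬⊤ _)
T-not⇔¬T {false} = mk⇔ (λ _ ()) (λ _ → _)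

T-does⇒ : {A : Set} (a? : Dec A) → T (does a?) → A
T-does⇒ (yes a) _ = a

ifᵇ-0 : (c : Bool) → ifᵇ c 0ℚ ≡ 0ℚ
ifᵇ-0 true  = refl
ifᵇ-0 false = refl

ifᵇ-≢0 : (c : Bool) {q : ℚ} → ifᵇ c q ≢ 0ℚ → T c
ifᵇ-≢0 true  _   = _
ifᵇ-≢0 false q≢0 = ⊥-elim (q≢0 refl)

ifᵇ-T : {c : Bool} {q : ℚ} → T c → ifᵇ c q ≡ q
ifᵇ-T {true} _ = refl

ifᵇ-¬T : {c : Bool} {q : ℚ} → ¬ T c → ifᵇ c q ≡ 0ℚ
ifᵇ-¬T {true}  ¬c = ⊥-elim (¬c _)
ifᵇ-¬T {false} _  = refl

ifᵇ-*ˡ : (c : Bool) (p q : ℚ) → ifᵇ c p * q ≡ ifᵇ c (p * q)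
ifᵇ-*ˡ true  p q = refl
ifᵇ-*ˡ false p q = *-zeroˡ q

ifᵇ-∧-* : (a e : Bool) (σ q : ℚ) → ifᵇ (a ∧ e) σ * q ≡ ifᵇ e (ifᵇ a σ * q)
ifᵇ-∧-* true  e     σ q = ifᵇ-*ˡ e σ q
ifᵇ-∧-* false true  σ q = refl
ifᵇ-∧-* false false σ q = *-zeroˡ q

𝟙 : Bool → ℚ
𝟙 c = ifᵇ c 1ℚ

ifᵇ≡𝟙* : (c : Bool) (q : ℚ) → ifᵇ c q ≡ 𝟙 c * q
ifᵇ≡𝟙* true  q = sym (*-identityˡ q)
ifᵇ≡𝟙* false q = sym (*-zeroˡ q)

sumMap-ifᵇ : {A : Set} (c : Bool) (f : A → ℚ) (xs : List A) → sumMap (λ a → ifᵇ c (f a)) xs ≡ ifᵇ c (sumMap f xs)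
sumMap-ifᵇ true  f xs = refl
sumMap-ifᵇ false f xs = sumMap-zero xs (λ _ → refl)

sumMap-filterᵇ : {A : Set} (P : A → Bool) (f : A → ℚ) (xs : List A) →
  sumMap f (filterᵇ P xs) ≡ sumMap (λ a → ifᵇ (P a) (f a)) xs
sumMap-filterᵇ P f []       = refl
sumMap-filterᵇ P f (x ∷ xs) with P x
... | true  = cong (f x +_) (sumMap-filterᵇ P f xs)
... | false = trans (sumMap-filterᵇ P f xs) (sym (+-identityˡ _))

sumMap-filterᵇ-cong : {A : Set} (P : A → Bool) {f g : A → ℚ} (xs : List A) → (∀ a → T (P a) → f a ≡ g a) →
  sumMap f (filterᵇ P xs) ≡ sumMap g (filterᵇ P xs)
sumMap-filterᵇ-cong P []       f≗g = refl
sumMap-filterᵇ-cong P (x ∷ xs) f≗g with P x in Px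
... | true  = cong₂ _+_ (f≗g x (Equivalence.from T-≡ Px)) (sumMap-filterᵇ-cong P xs f≗g)
... | false = sumMap-filterᵇ-cong P xs f≗g

data ↑-View (a b : ℕ) : Fin (a ℕ.+ b) → Set where
  left  : (i : Fin a) → ↑-View a b (i ↑ˡ b)
  right : (j : Fin b) → ↑-View a b (a ↑ʳ j)

↑-view : (a b : ℕ) (k : Fin (a ℕ.+ b)) → ↑-View a b k
↑-view a b k with splitAt a k | join-splitAt a b k
... | inj₁ i | refl = left i
... | inj₂ j | refl = right j

Family : ℕ → ℕ → Set
Family m r = Vector (Vector ℚ m) r

δ : {r : ℕ} → Fin r → Fin r → ℚ
δ i j = ifᵇ (does (i ≟ᶠ j)) 1ℚ

δ-diag : {r : ℕ} (i : Fin r) → δ i i ≡ 1ℚ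
δ-diag i = cong (λ b → ifᵇ b 1ℚ) (dec-true (i ≟ᶠ i) refl)

δ-off : {r : ℕ} {i j : Fin r} → i ≢ j → δ i j ≡ 0ℚ
δ-off {i = i} {j} i≢j = cong (λ b → ifᵇ b 1ℚ) (dec-false (i ≟ᶠ j) i≢j)

module _ {m : ℕ} where

  -- lincomb and _·_ unfold to exactly the sums in IsKerDim and _*ᵥ_ of Defs: (M *ᵥ v) i is M i · v.
  lincomb : {r : ℕ} → Family m r → Vector ℚ r → Vector ℚ m
  lincomb F c j = sumFin (λ i → c i * F i j)

  infix 4 _∈Span_ _⊆Span_

  _∈Span_ : {r : ℕ} → Vector ℚ m → Family m r → Set
  v ∈Span F = Σ (Vector ℚ _) λ c → v ≗ lincomb F c

  _⊆Span_ : {r s : ℕ} → Family m r → Family m s → Set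
  F ⊆Span G = ∀ i → F i ∈Span G

  Independent : {r : ℕ} → Family m r → Set
  Independent F = ∀ c → (∀ j → lincomb F c j ≡ 0ℚ) → ∀ i → c i ≡ 0ℚ

  infix 7 _·_

  _·_ : Vector ℚ m → Vector ℚ m → ℚ
  u · v = sumFin (λ j → u j * v j)

  Orthogonal : {r : ℕ} → Family m r → Set
  Orthogonal F = ∀ i j → i ≢ j → F i · F j ≡ 0ℚ

  NonNull : {r : ℕ} → Family m r → Set
  NonNull F = ∀ i → F i · F i ≢ 0ℚ

  lincomb-δ : {r : ℕ} (F : Family m r) (i : Fin r) → F i ≗ lincomb F (δ i)
  lincomb-δ F i j = sym (begin
    sumFin (λ l → δ i l * F l j)
      ≡⟨ sumFin-single _ i (λ l l≢i → trans (cong (_* F l j) (δ-off (l≢i ∘ sym))) (*-zeroˡ (F l j))) ⟩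
    δ i i * F i j
      ≡⟨ cong (_* F i j) (δ-diag i) ⟩
    1ℚ * F i j
      ≡⟨ *-identityˡ (F i j) ⟩
    F i j
      ∎)
    where open ≡-Reasoning

  lincomb-cong : {r : ℕ} (F : Family m r) {c c′ : Vector ℚ r} → c ≗ c′ → lincomb F c ≗ lincomb F c′
  lincomb-cong F c≗c′ j = sumFin-cong (λ i → cong (_* F i j) (c≗c′ i))

  lincomb-0 : {r : ℕ} (F : Family m r) → lincomb F (λ _ → 0ℚ) ≗ (λ _ → 0ℚ)
  lincomb-0 F j = sumFin-zero (λ i → *-zeroˡ (F i j))

  lincomb-+ : {r : ℕ} (F : Family m r) (c c′ : Vector ℚ r) →
    lincomb F (λ i → c i + c′ i) ≗ (λ j → lincomb F c j + lincomb F c′ j)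
  lincomb-+ F c c′ j = trans (sumFin-cong (λ i → *-distribʳ-+ (F i j) (c i) (c′ i)))
                             (sumFin-+ (λ i → c i * F i j) (λ i → c′ i * F i j))

  lincomb-neg : {r : ℕ} (F : Family m r) (c : Vector ℚ r) → lincomb F (λ i → - c i) ≗ (λ j → - lincomb F c j)
  lincomb-neg F c j = trans (sumFin-cong (λ i → sym (neg-distribˡ-* (c i) (F i j)))) (sumFin-neg (λ i → c i * F i j))

  lincomb-lincomb : {r s : ℕ} (F : Family m r) (G : Family m s) (N : Vector (Vector ℚ s) r) →
    (∀ i → F i ≗ lincomb G (N i)) → (c : Vector ℚ r) →
    lincomb F c ≗ lincomb G (λ l → sumFin (λ i → c i * N i l))
  lincomb-lincomb F G N F≗GN c j = begin
    sumFin (λ i → c i * F i j)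
      ≡⟨ sumFin-cong (λ i → cong (c i *_) (F≗GN i j)) ⟩
    sumFin (λ i → c i * sumFin (λ l → N i l * G l j))
      ≡⟨ sumFin-cong (λ i → sym (sumFin-*ˡ (c i) (λ l → N i l * G l j))) ⟩
    sumFin (λ i → sumFin (λ l → c i * (N i l * G l j)))
      ≡⟨ sumFin-comm (λ i l → c i * (N i l * G l j)) ⟩
    sumFin (λ l → sumFin (λ i → c i * (N i l * G l j)))
      ≡⟨ sumFin-cong (λ l → sumFin-cong (λ i → sym (*-assoc (c i) (N i l) (G l j)))) ⟩
    sumFin (λ l → sumFin (λ i → c i * N i l * G l j))
      ≡⟨ sumFin-cong (λ l → sumFin-*ʳ (G l j) (λ i → c i * N i l)) ⟩
    sumFin (λ l → sumFin (λ i → c i * N i l) * G l j)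
      ∎
    where open ≡-Reasoning

  ∈Span-member : {r : ℕ} (F : Family m r) (i : Fin r) → F i ∈Span F
  ∈Span-member F i = δ i , lincomb-δ F i

  ∈Span-lincomb : {r : ℕ} (F : Family m r) (c : Vector ℚ r) → lincomb F c ∈Span F
  ∈Span-lincomb F c = c , λ _ → refl

  ∈Span-resp-≗ : {r : ℕ} (F : Family m r) {u v : Vector ℚ m} → u ≗ v → u ∈Span F → v ∈Span F
  ∈Span-resp-≗ F u≗v (c , u≗Fc) = c , λ j → trans (sym (u≗v j)) (u≗Fc j)

  ∈Span-+ : {r : ℕ} (F : Family m r) {u v : Vector ℚ m} → u ∈Span F → v ∈Span F → (λ j → u j + v j) ∈Span F
  ∈Span-+ F (c , u≗Fc) (c′ , v≗Fc′) = (λ i → c i + c′ i) , λ j →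
    trans (cong₂ _+_ (u≗Fc j) (v≗Fc′ j)) (sym (lincomb-+ F c c′ j))

  ∈Span-neg : {r : ℕ} (F : Family m r) {v : Vector ℚ m} → v ∈Span F → (λ j → - v j) ∈Span F
  ∈Span-neg F (c , v≗Fc) = (λ i → - c i) , λ j → trans (cong -_ (v≗Fc j)) (sym (lincomb-neg F c j))

  ∈Span-trans : {r s : ℕ} {F : Family m r} (G : Family m s) {v : Vector ℚ m} → v ∈Span F → F ⊆Span G → v ∈Span G
  ∈Span-trans {F = F} G (c , v≗Fc) F⊆G =
    (λ l → sumFin (λ i → c i * proj₁ (F⊆G i) l)) ,
    λ j → trans (v≗Fc j) (lincomb-lincomb F G (proj₁ ∘ F⊆G) (proj₂ ∘ F⊆G) c j)

  ⊆Span-trans : {r s t : ℕ} {F : Family m r} {G : Family m s} (H : Family m t) → F ⊆Span G → G ⊆Span H → F ⊆Span H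
  ⊆Span-trans H F⊆G G⊆H i = ∈Span-trans H (F⊆G i) G⊆H

  ·-comm : (u v : Vector ℚ m) → u · v ≡ v · u
  ·-comm u v = sumFin-cong (λ j → *-comm (u j) (v j))

  ·-congˡ : {u u′ : Vector ℚ m} (v : Vector ℚ m) → u ≗ u′ → u · v ≡ u′ · v
  ·-congˡ v u≗u′ = sumFin-cong (λ j → cong (_* v j) (u≗u′ j))

  ·-congʳ : (u : Vector ℚ m) {v v′ : Vector ℚ m} → v ≗ v′ → u · v ≡ u · v′
  ·-congʳ u v≗v′ = sumFin-cong (λ j → cong (u j *_) (v≗v′ j))

  ·-zeroʳ : (u : Vector ℚ m) {v : Vector ℚ m} → v ≗ (λ _ → 0ℚ) → u · v ≡ 0ℚ
  ·-zeroʳ u v≗0 = sumFin-zero (λ j → trans (cong (u j *_) (v≗0 j)) (*-zeroʳ (u j)))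

  ·-zeroˡ : {u : Vector ℚ m} (v : Vector ℚ m) → u ≗ (λ _ → 0ℚ) → u · v ≡ 0ℚ
  ·-zeroˡ v u≗0 = sumFin-zero (λ j → trans (cong (_* v j) (u≗0 j)) (*-zeroˡ (v j)))

  ·-+ˡ : (u u′ v : Vector ℚ m) → (λ j → u j + u′ j) · v ≡ u · v + u′ · v
  ·-+ˡ u u′ v =
    trans (sumFin-cong (λ j → *-distribʳ-+ (v j) (u j) (u′ j))) (sumFin-+ (λ j → u j * v j) (λ j → u′ j * v j))

  ·-+ʳ : (u v v′ : Vector ℚ m) → u · (λ j → v j + v′ j) ≡ u · v + u · v′
  ·-+ʳ u v v′ =
    trans (sumFin-cong (λ j → *-distribˡ-+ (u j) (v j) (v′ j))) (sumFin-+ (λ j → u j * v j) (λ j → u j * v′ j))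

  ·--ˡ : (u u′ v : Vector ℚ m) → (λ j → u j - u′ j) · v ≡ u · v - u′ · v
  ·--ˡ u u′ v = trans (·-+ˡ u (λ j → - u′ j) v) (cong (u · v +_)
    (trans (sumFin-cong (λ j → sym (neg-distribˡ-* (u′ j) (v j)))) (sumFin-neg (λ j → u′ j * v j))))

  ·-lincombˡ : {r : ℕ} (F : Family m r) (c : Vector ℚ r) (v : Vector ℚ m) →
    lincomb F c · v ≡ sumFin (λ i → c i * (F i · v))
  ·-lincombˡ F c v = begin
    sumFin (λ j → sumFin (λ i → c i * F i j) * v j)
      ≡⟨ sumFin-cong (λ j → sym (sumFin-*ʳ (v j) (λ i → c i * F i j))) ⟩
    sumFin (λ j → sumFin (λ i → c i * F i j * v j))
      ≡⟨ sumFin-comm (λ j i → c i * F i j * v j) ⟩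
    sumFin (λ i → sumFin (λ j → c i * F i j * v j))
      ≡⟨ sumFin-cong (λ i → sumFin-cong (λ j → *-assoc (c i) (F i j) (v j))) ⟩
    sumFin (λ i → sumFin (λ j → c i * (F i j * v j)))
      ≡⟨ sumFin-cong (λ i → sumFin-*ˡ (c i) (λ j → F i j * v j)) ⟩
    sumFin (λ i → c i * (F i · v))
      ∎
    where open ≡-Reasoning

  0≤v·v : (v : Vector ℚ m) → 0ℚ ≤ v · v
  0≤v·v v = sumFin-nonNeg (λ j → v j * v j) (λ j → 0≤p*p (v j))

  v·v≡0⇒v≗0 : (v : Vector ℚ m) → v · v ≡ 0ℚ → v ≗ (λ _ → 0ℚ)
  v·v≡0⇒v≗0 v v·v≡0 j = p*p≡0⇒p≡0 (v j) (sumFin-nonNeg≡0 (λ j → v j * v j) (λ j → 0≤p*p (v j)) v·v≡0 j)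

  ∈Span-⊥ : {r : ℕ} (F : Family m r) (v : Vector ℚ m) → (∀ i → F i · v ≡ 0ℚ) →
    {u : Vector ℚ m} → u ∈Span F → u · v ≡ 0ℚ
  ∈Span-⊥ F v F⊥v {u} (c , u≗Fc) = begin
    u · v                          ≡⟨ ·-congˡ v u≗Fc ⟩
    lincomb F c · v                ≡⟨ ·-lincombˡ F c v ⟩
    sumFin (λ i → c i * (F i · v)) ≡⟨ sumFin-zero (λ i → trans (cong (c i *_) (F⊥v i)) (*-zeroʳ (c i))) ⟩
    0ℚ                             ∎
    where open ≡-Reasoning

  span-⊥-span : {r s : ℕ} (F : Family m r) (G : Family m s) → (∀ i j → F i · G j ≡ 0ℚ) →
    {u v : Vector ℚ m} → u ∈Span F → v ∈Span G → u · v ≡ 0ℚ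
  span-⊥-span F G F⊥G u∈F v∈G =
    ∈Span-⊥ F _ (λ i → trans (·-comm (F i) _) (∈Span-⊥ G (F i) (λ j → trans (·-comm (G j) (F i)) (F⊥G i j)) v∈G)) u∈F

  ∈Span∧⊥⇒≗0 : {r : ℕ} (F : Family m r) {v : Vector ℚ m} → v ∈Span F → (∀ i → F i · v ≡ 0ℚ) → v ≗ (λ _ → 0ℚ)
  ∈Span∧⊥⇒≗0 F v∈F F⊥v = v·v≡0⇒v≗0 _ (∈Span-⊥ F _ F⊥v v∈F)

  orthogonal-coefficient : {r : ℕ} (F : Family m r) → Orthogonal F → (c : Vector ℚ r) (i : Fin r) →
    lincomb F c · F i ≡ c i * (F i · F i)
  orthogonal-coefficient F orth c i = trans (·-lincombˡ F c (F i))
    (sumFin-single _ i (λ l l≢i → trans (cong (c l *_) (orth l i l≢i)) (*-zeroʳ (c l))))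

  orthogonal⇒independent : {r : ℕ} (F : Family m r) → Orthogonal F → NonNull F → Independent F
  orthogonal⇒independent F orth nonNull c Fc≗0 i = [ id , ⊥-elim ∘ nonNull i ]′
    (p*q≡0⇒p≡0⊎q≡0 (c i) (F i · F i) (trans (sym (orthogonal-coefficient F orth c i)) (·-zeroˡ (F i) Fc≗0)))

  nonNull∧null⇒empty : {r : ℕ} (F : Family m r) → NonNull F → (∀ i → F i ≗ (λ _ → 0ℚ)) → r ≡ 0
  nonNull∧null⇒empty {ℕ.zero}  F _       _    = refl
  nonNull∧null⇒empty {ℕ.suc r} F nonNull null = ⊥-elim (nonNull zero (·-zeroˡ (F zero) (null zero)))

  lincomb-injective : {r : ℕ} (F : Family m r) → Independent F → (c c′ : Vector ℚ r) →
    lincomb F c ≗ lincomb F c′ → c ≗ c′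
  lincomb-injective F indep c c′ Fc≗Fc′ i = begin
    c i                    ≡⟨ solve (c i) (c′ i) ⟩
    (c i - c′ i) + c′ i    ≡⟨ cong (_+ c′ i) (indep (λ l → c l - c′ l) difference≗0 i) ⟩
    0ℚ + c′ i              ≡⟨ +-identityˡ (c′ i) ⟩
    c′ i                   ∎
    where
    open ≡-Reasoning
    solve : ∀ a b → a ≡ (a - b) + b
    solve = solve-∀ ℚ-ring
    difference≗0 : ∀ j → lincomb F (λ l → c l - c′ l) j ≡ 0ℚ
    difference≗0 j = begin
      lincomb F (λ l → c l - c′ l) j          ≡⟨ lincomb-+ F c (λ l → - c′ l) j ⟩
      lincomb F c j + lincomb F (λ l → - c′ l) j ≡⟨ cong (lincomb F c j +_) (lincomb-neg F c′ j) ⟩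
      lincomb F c j - lincomb F c′ j          ≡⟨ cong (_- lincomb F c′ j) (Fc≗Fc′ j) ⟩
      lincomb F c′ j - lincomb F c′ j         ≡⟨ +-inverseʳ (lincomb F c′ j) ⟩
      0ℚ                                      ∎

  -- The change-of-basis matrices M and N are mutually inverse, so r = tr (M N) = tr (N M) = s.
  independent-spanning-size : {r s : ℕ} (B : Family m r) (C : Family m s) →
    Independent B → Independent C → B ⊆Span C → C ⊆Span B → r ≡ s
  independent-spanning-size {r} {s} B C indepB indepC B⊆C C⊆B =
    card-injective r s (begin
      card r
        ≡⟨ sumFin-cong (λ i → sym (trans (MN≡δ i i) (δ-diag i))) ⟩
      sumFin (λ i → sumFin (λ k → M i k * N k i))
        ≡⟨ sumFin-comm (λ i k → M i k * N k i) ⟩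
      sumFin (λ k → sumFin (λ i → M i k * N k i))
        ≡⟨ sumFin-cong (λ k → sumFin-cong (λ i → *-comm (M i k) (N k i))) ⟩
      sumFin (λ k → sumFin (λ i → N k i * M i k))
        ≡⟨ sumFin-cong (λ k → trans (NM≡δ k k) (δ-diag k)) ⟩
      card s
        ∎)
    where
    open ≡-Reasoning
    M : Vector (Vector ℚ s) r
    M = proj₁ ∘ B⊆C
    N : Vector (Vector ℚ r) s
    N = proj₁ ∘ C⊆B
    MN≡δ : ∀ i l → sumFin (λ k → M i k * N k l) ≡ δ i l
    MN≡δ i = lincomb-injective B indepB _ (δ i) (λ j → begin
      lincomb B (λ l → sumFin (λ k → M i k * N k l)) j ≡⟨ sym (lincomb-lincomb C B N (proj₂ ∘ C⊆B) (M i) j) ⟩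
      lincomb C (M i) j                                ≡⟨ sym (proj₂ (B⊆C i) j) ⟩
      B i j                                            ≡⟨ lincomb-δ B i j ⟩
      lincomb B (δ i) j                                ∎)
    NM≡δ : ∀ k l → sumFin (λ i → N k i * M i l) ≡ δ k l
    NM≡δ k = lincomb-injective C indepC _ (δ k) (λ j → begin
      lincomb C (λ l → sumFin (λ i → N k i * M i l)) j ≡⟨ sym (lincomb-lincomb B C M (proj₂ ∘ B⊆C) (N k) j) ⟩
      lincomb B (N k) j                                ≡⟨ sym (proj₂ (C⊆B k) j) ⟩
      C k j                                            ≡⟨ lincomb-δ C k j ⟩
      lincomb C (δ k) j                                ∎)

  basis-size : {r : ℕ} (F : Family m r) → Independent F → (∀ v → v ∈Span F) → r ≡ m
  basis-size F indep spanning = independent-spanning-size F δ indep δ-independent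
    (λ i → spanning-δ (F i)) (λ j → spanning (δ j))
    where
    δ-coordinates : (c : Vector ℚ m) → lincomb δ c ≗ c
    δ-coordinates c j = begin
      sumFin (λ i → c i * δ i j) ≡⟨ sumFin-single _ j (λ i i≢j → trans (cong (c i *_) (δ-off i≢j)) (*-zeroʳ (c i))) ⟩
      c j * δ j j                ≡⟨ cong (c j *_) (δ-diag j) ⟩
      c j * 1ℚ                   ≡⟨ *-identityʳ (c j) ⟩
      c j                        ∎
      where open ≡-Reasoning
    δ-independent : Independent δ
    δ-independent c δc≗0 j = trans (sym (δ-coordinates c j)) (δc≗0 j)
    spanning-δ : (v : Vector ℚ m) → v ∈Span δ
    spanning-δ v = v , λ j → sym (δ-coordinates v j)

  module _ {r : ℕ} (H : Family m r) (nonNull : NonNull H) where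

    coordinate : Vector ℚ m → Vector ℚ r
    coordinate v i = (v · H i) * 1/ (H i · H i)
      where instance _ = ≢-nonZero (nonNull i)

    projection : Vector ℚ m → Vector ℚ m
    projection v = lincomb H (coordinate v)

    residual : Vector ℚ m → Vector ℚ m
    residual v j = v j - projection v j

    projection+residual : (v : Vector ℚ m) → v ≗ (λ j → projection v j + residual v j)
    projection+residual v j = solve (v j) (projection v j)
      where
      solve : ∀ a b → a ≡ b + (a - b)
      solve = solve-∀ ℚ-ring

    residual-⊥ : Orthogonal H → (v : Vector ℚ m) (i : Fin r) → residual v · H i ≡ 0ℚ
    residual-⊥ orth v i = begin
      residual v · H i
        ≡⟨ ·--ˡ v (projection v) (H i) ⟩
      v · H i - projection v · H i
        ≡⟨ cong (λ x → v · H i - x) (orthogonal-coefficient H orth (coordinate v) i) ⟩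
      v · H i - (v · H i) * 1/ (H i · H i) * (H i · H i)
        ≡⟨ cong (λ x → v · H i - x) (*-assoc (v · H i) _ _) ⟩
      v · H i - (v · H i) * (1/ (H i · H i) * (H i · H i))
        ≡⟨ cong (λ x → v · H i - (v · H i) * x) (*-inverseˡ (H i · H i)) ⟩
      v · H i - (v · H i) * 1ℚ
        ≡⟨ cong (λ x → v · H i - x) (*-identityʳ (v · H i)) ⟩
      v · H i - v · H i
        ≡⟨ +-inverseʳ (v · H i) ⟩
      0ℚ
        ∎
      where
      open ≡-Reasoning
      instance _ = ≢-nonZero (nonNull i)

  record OrthogonalBasis {s : ℕ} (W : Family m s) : Set where
    field
      size       : ℕ
      basis      : Family m size
      orthogonal : Orthogonal basis
      nonNull    : NonNull basis
      spans      : W ⊆Span basis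
      within     : basis ⊆Span W

  gramSchmidt : {s : ℕ} (W : Family m s) → OrthogonalBasis W
  gramSchmidt {ℕ.zero}  W = record
    { size = 0 ; basis = λ () ; orthogonal = λ () ; nonNull = λ () ; spans = λ () ; within = λ () }
  gramSchmidt {ℕ.suc s} W = extend (u · u ≟ 0ℚ)
    where
    module R = OrthogonalBasis (gramSchmidt (W ∘ suc))
    p u : Vector ℚ m
    p = projection R.basis R.nonNull (W zero)
    u = residual R.basis R.nonNull (W zero)
    W₀≗p+u : W zero ≗ (λ j → p j + u j)
    W₀≗p+u = projection+residual R.basis R.nonNull (W zero)
    p∈R : p ∈Span R.basis
    p∈R = ∈Span-lincomb R.basis (coordinate R.basis R.nonNull (W zero))
    R⊆W : R.basis ⊆Span W
    R⊆W = ⊆Span-trans W R.within (λ i → ∈Span-member W (suc i))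
    extend : Dec (u · u ≡ 0ℚ) → OrthogonalBasis W
    extend (yes u·u≡0) = record
      { R
      ; spans  = λ { zero → ∈Span-resp-≗ R.basis p≗W₀ p∈R ; (suc i) → R.spans i }
      ; within = R⊆W
      }
      where
      p≗W₀ : p ≗ W zero
      p≗W₀ j = sym (trans (W₀≗p+u j) (trans (cong (p j +_) (v·v≡0⇒v≗0 u u·u≡0 j)) (+-identityʳ (p j))))
    extend (no u·u≢0) = record
      { size       = ℕ.suc R.size
      ; basis      = H
      ; orthogonal = orthogonal
      ; nonNull    = λ { zero → u·u≢0 ; (suc i) → R.nonNull i }
      ; spans      = λ { zero → ∈Span-resp-≗ H (sym ∘ W₀≗p+u) (∈Span-+ H (∈Span-trans H p∈R R⊆H) (∈Span-member H zero))
                       ; (suc i) → ∈Span-trans H (R.spans i) R⊆H }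
      ; within     = λ { zero → ∈Span-+ W (∈Span-member W zero) (∈Span-neg W (∈Span-trans W p∈R R⊆W))
                       ; (suc i) → R⊆W i }
      }
      where
      H = u ∷ᶠ R.basis
      R⊆H : R.basis ⊆Span H
      R⊆H i = ∈Span-member H (suc i)
      u⊥R : ∀ i → u · R.basis i ≡ 0ℚ
      u⊥R = residual-⊥ R.basis R.nonNull R.orthogonal (W zero)
      orthogonal : Orthogonal H
      orthogonal zero    zero    0≢0 = ⊥-elim (0≢0 refl)
      orthogonal zero    (suc j) _   = u⊥R j
      orthogonal (suc i) zero    _   = trans (·-comm (R.basis i) u) (u⊥R i)
      orthogonal (suc i) (suc j) i≢j = R.orthogonal i j (i≢j ∘ cong suc)

  module _ {a b : ℕ} (F : Family m a) (E : Family m b) where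

    ⊆Span-++ˡ : F ⊆Span (F ++ᶠ E)
    ⊆Span-++ˡ i = ∈Span-resp-≗ (F ++ᶠ E) (λ j → cong (_$ j) (lookup-++ˡ F E i)) (∈Span-member (F ++ᶠ E) (i ↑ˡ b))

    ⊆Span-++ʳ : E ⊆Span (F ++ᶠ E)
    ⊆Span-++ʳ k = ∈Span-resp-≗ (F ++ᶠ E) (λ j → cong (_$ j) (lookup-++ʳ F E k)) (∈Span-member (F ++ᶠ E) (a ↑ʳ k))

    lincomb-++ : (c : Vector ℚ (a ℕ.+ b)) →
      lincomb (F ++ᶠ E) c ≗ (λ j → lincomb F (c ∘ (_↑ˡ b)) j + lincomb E (c ∘ (a ↑ʳ_)) j)
    lincomb-++ c j = trans (sumFin-↑ a b (λ k → c k * (F ++ᶠ E) k j)) (cong₂ _+_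
      (sumFin-cong (λ i → cong (λ w → c (i ↑ˡ b) * w j) (lookup-++ˡ F E i)))
      (sumFin-cong (λ k → cong (λ w → c (a ↑ʳ k) * w j) (lookup-++ʳ F E k))))

    ++-nonNull : NonNull F → NonNull E → NonNull (F ++ᶠ E)
    ++-nonNull nonNullF nonNullE k with ↑-view a b k
    ... | left  i rewrite lookup-++ˡ F E i = nonNullF i
    ... | right j rewrite lookup-++ʳ F E j = nonNullE j

    ++-orthogonal : Orthogonal F → Orthogonal E → (∀ i j → F i · E j ≡ 0ℚ) → Orthogonal (F ++ᶠ E)
    ++-orthogonal orthF orthE F⊥E k l k≢l with ↑-view a b k | ↑-view a b l
    ... | left i  | left i′
      rewrite lookup-++ˡ F E i | lookup-++ˡ F E i′ = orthF i i′ (k≢l ∘ cong (_↑ˡ b))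
    ... | left i  | right j
      rewrite lookup-++ˡ F E i | lookup-++ʳ F E j = F⊥E i j
    ... | right j | left i
      rewrite lookup-++ʳ F E j | lookup-++ˡ F E i = trans (·-comm (E j) (F i)) (F⊥E i j)
    ... | right j | right j′
      rewrite lookup-++ʳ F E j | lookup-++ʳ F E j′ = orthE j j′ (k≢l ∘ cong (a ↑ʳ_))

    ++-independent : Orthogonal F → NonNull F → Independent E → (∀ i k → F i · E k ≡ 0ℚ) → Independent (F ++ᶠ E)
    ++-independent orthF nonNullF indepE F⊥E c Tc≗0 l = byView l (↑-view a b l)
      where
      cF : Vector ℚ a
      cF = c ∘ (_↑ˡ b)
      cE : Vector ℚ b
      cE = c ∘ (a ↑ʳ_)
      parts≗0 : ∀ j → lincomb F cF j + lincomb E cE j ≡ 0ℚ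
      parts≗0 j = trans (sym (lincomb-++ c j)) (Tc≗0 j)
      cF≡0 : ∀ i → cF i ≡ 0ℚ
      cF≡0 i = [ id , ⊥-elim ∘ nonNullF i ]′ (p*q≡0⇒p≡0⊎q≡0 (cF i) (F i · F i) (begin
        cF i * (F i · F i)                             ≡⟨ sym (orthogonal-coefficient F orthF cF i) ⟩
        lincomb F cF · F i                             ≡⟨ sym (+-identityʳ _) ⟩
        lincomb F cF · F i + 0ℚ                        ≡⟨ cong (lincomb F cF · F i +_) (sym Ec⊥Fi) ⟩
        lincomb F cF · F i + lincomb E cE · F i        ≡⟨ sym (·-+ˡ (lincomb F cF) (lincomb E cE) (F i)) ⟩
        (λ j → lincomb F cF j + lincomb E cE j) · F i  ≡⟨ ·-zeroˡ (F i) parts≗0 ⟩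
        0ℚ                                             ∎))
        where
        open ≡-Reasoning
        Ec⊥Fi : lincomb E cE · F i ≡ 0ℚ
        Ec⊥Fi = ∈Span-⊥ E (F i) (λ k → trans (·-comm (E k) (F i)) (F⊥E i k)) (∈Span-lincomb E cE)
      cE≡0 : ∀ k → cE k ≡ 0ℚ
      cE≡0 = indepE cE (λ j → begin
        lincomb E cE j
          ≡⟨ sym (+-identityˡ _) ⟩
        0ℚ + lincomb E cE j
          ≡⟨ cong (_+ lincomb E cE j) (sym (trans (lincomb-cong F cF≡0 j) (lincomb-0 F j))) ⟩
        lincomb F cF j + lincomb E cE j
          ≡⟨ parts≗0 j ⟩
        0ℚ
          ∎)
        where open ≡-Reasoning
      byView : ∀ l → ↑-View a b l → c l ≡ 0ℚ
      byView _ (left i)  = cF≡0 i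
      byView _ (right k) = cE≡0 k

    ++-spanning : Orthogonal F → NonNull F → (∀ u → (∀ i → F i · u ≡ 0ℚ) → u ∈Span E) → ∀ v → v ∈Span (F ++ᶠ E)
    ++-spanning orthF nonNullF complement v =
      ∈Span-resp-≗ (F ++ᶠ E) (λ j → sym (projection+residual F nonNullF v j)) (∈Span-+ (F ++ᶠ E)
        (∈Span-trans (F ++ᶠ E) (∈Span-lincomb F (coordinate F nonNullF v)) ⊆Span-++ˡ)
        (∈Span-trans (F ++ᶠ E) (complement (residual F nonNullF v) residual⊥F) ⊆Span-++ʳ))
      where
      residual⊥F : ∀ i → F i · residual F nonNullF v ≡ 0ℚ
      residual⊥F i = trans (·-comm (F i) _) (residual-⊥ F nonNullF orthF v i)

  module _ {a b : ℕ} (F : Family m a) (E : Family m b) {v : Vector ℚ m} where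

    ++-⊥ : (∀ i → F i · v ≡ 0ℚ) → (∀ j → E j · v ≡ 0ℚ) → ∀ k → (F ++ᶠ E) k · v ≡ 0ℚ
    ++-⊥ F⊥v E⊥v k with ↑-view a b k
    ... | left  i rewrite lookup-++ˡ F E i = F⊥v i
    ... | right j rewrite lookup-++ʳ F E j = E⊥v j

    ++-⊥⁻ : (∀ k → (F ++ᶠ E) k · v ≡ 0ℚ) → (∀ i → F i · v ≡ 0ℚ) × (∀ j → E j · v ≡ 0ℚ)
    ++-⊥⁻ T⊥v = (λ i → ∈Span-⊥ (F ++ᶠ E) v T⊥v (⊆Span-++ˡ F E i)) , (λ j → ∈Span-⊥ (F ++ᶠ E) v T⊥v (⊆Span-++ʳ F E j))

nonNull-in-ℚ⁰ : {m r : ℕ} → m ≡ 0 → (F : Family m r) → NonNull F → r ≡ 0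
nonNull-in-ℚ⁰ refl F nonNull = nonNull∧null⇒empty F nonNull (λ i ())

IsKerDim-cong : {m r : ℕ} {M M′ : Fin m → Fin m → ℚ} → (∀ i j → M i j ≡ M′ i j) → IsKerDim M r → IsKerDim M′ r
IsKerDim-cong M≡M′ (B , B-kernel , B-independent , B-spanning) =
  B , (λ l i → trans (sumFin-cong (λ j → cong (_* B l j) (sym (M≡M′ i j)))) (B-kernel l i)) , B-independent ,
  (λ v v-kernel → B-spanning v (λ i → trans (sumFin-cong (λ j → cong (_* v j) (M≡M′ i j))) (v-kernel i)))

record CochainComplex : Set where
  field
    size : ℕ → ℕ
    d    : (k : ℕ) → Fin (size (ℕ.suc k)) → Fin (size k) → ℚ
    d∘d  : ∀ k p j → sumFin (λ l → d (ℕ.suc k) p l * d k l j) ≡ 0ℚ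

module Hodge (C : CochainComplex) where

  open CochainComplex C

  size⁻ : ℕ → ℕ
  size⁻ ℕ.zero    = 0
  size⁻ (ℕ.suc k) = size k

  d⁻ : (k : ℕ) → Fin (size k) → Fin (size⁻ k) → ℚ
  d⁻ ℕ.zero    i ()
  d⁻ (ℕ.suc k) = d k

  -- rows k p is the p-th row of the matrix of d k, so (d v) p = rows k p · v;
  -- cols k q is the q-th column of the matrix of d (k - 1), so these span the image of d in degree k.
  rows : (k : ℕ) → Family (size k) (size (ℕ.suc k))
  rows k p i = d k p i

  cols : (k : ℕ) → Family (size k) (size⁻ k)
  cols k q i = d⁻ k i q

  rows⊥cols : ∀ k p q → rows k p · cols k q ≡ 0ℚ
  rows⊥cols (ℕ.suc k) p q = d∘d k p q

  laplacian : (k : ℕ) → Fin (size k) → Fin (size k) → ℚ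
  laplacian k i j = sumFin (λ p → d k p i * d k p j) + sumFin (λ q → d⁻ k i q * d⁻ k j q)

  laplacian-*ᵥ : (k : ℕ) (v : Vector ℚ (size k)) →
    (laplacian k *ᵥ v) ≗ (λ i → lincomb (rows k) (λ p → rows k p · v) i + lincomb (cols k) (λ q → cols k q · v) i)
  laplacian-*ᵥ k v i = begin
    (λ j → lincomb (rows k) (rowsᵢ) j + lincomb (cols k) colsᵢ j) · v
      ≡⟨ ·-+ˡ (lincomb (rows k) rowsᵢ) (lincomb (cols k) colsᵢ) v ⟩
    lincomb (rows k) rowsᵢ · v + lincomb (cols k) colsᵢ · v
      ≡⟨ cong₂ _+_ (·-lincombˡ (rows k) rowsᵢ v) (·-lincombˡ (cols k) colsᵢ v) ⟩
    sumFin (λ p → rowsᵢ p * (rows k p · v)) + sumFin (λ q → colsᵢ q * (cols k q · v))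
      ≡⟨ cong₂ _+_ (sumFin-cong (λ p → *-comm (rowsᵢ p) _)) (sumFin-cong (λ q → *-comm (colsᵢ q) _)) ⟩
    lincomb (rows k) (λ p → rows k p · v) i + lincomb (cols k) (λ q → cols k q · v) i
      ∎
    where
    open ≡-Reasoning
    rowsᵢ = λ p → rows k p i
    colsᵢ = λ q → cols k q i

  laplacian-quadratic : (k : ℕ) (v : Vector ℚ (size k)) →
    v · (laplacian k *ᵥ v) ≡ (λ p → rows k p · v) · (λ p → rows k p · v) + (λ q → cols k q · v) · (λ q → cols k q · v)
  laplacian-quadratic k v = begin
    v · (laplacian k *ᵥ v)
      ≡⟨ ·-congʳ v (laplacian-*ᵥ k v) ⟩
    v · (λ i → lincomb (rows k) rows·v i + lincomb (cols k) cols·v i)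
      ≡⟨ ·-+ʳ v (lincomb (rows k) rows·v) (lincomb (cols k) cols·v) ⟩
    v · lincomb (rows k) rows·v + v · lincomb (cols k) cols·v
      ≡⟨ cong₂ _+_ (trans (·-comm v _) (·-lincombˡ (rows k) rows·v v))
                   (trans (·-comm v _) (·-lincombˡ (cols k) cols·v v)) ⟩
    rows·v · rows·v + cols·v · cols·v
      ∎
    where
    open ≡-Reasoning
    rows·v = λ p → rows k p · v
    cols·v = λ q → cols k q · v

  kernel⇒⊥ : (k : ℕ) (v : Vector ℚ (size k)) → InKernel (laplacian k) v →
    (∀ p → rows k p · v ≡ 0ℚ) × (∀ q → cols k q · v ≡ 0ℚ)
  kernel⇒⊥ k v Lv≗0 =
    v·v≡0⇒v≗0 rows·v (0≤p→0≤q→p+q≡0⇒p≡0 (0≤v·v rows·v) (0≤v·v cols·v) squares≡0) ,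
    v·v≡0⇒v≗0 cols·v (0≤p→0≤q→p+q≡0⇒p≡0 (0≤v·v cols·v) (0≤v·v rows·v)
      (trans (+-comm (cols·v · cols·v) (rows·v · rows·v)) squares≡0))
    where
    rows·v = λ p → rows k p · v
    cols·v = λ q → cols k q · v
    squares≡0 : rows·v · rows·v + cols·v · cols·v ≡ 0ℚ
    squares≡0 = trans (sym (laplacian-quadratic k v)) (·-zeroʳ v Lv≗0)

  ⊥⇒kernel : (k : ℕ) (v : Vector ℚ (size k)) →
    (∀ p → rows k p · v ≡ 0ℚ) → (∀ q → cols k q · v ≡ 0ℚ) → InKernel (laplacian k) v
  ⊥⇒kernel k v rows⊥v cols⊥v i = begin
    (laplacian k *ᵥ v) i
      ≡⟨ laplacian-*ᵥ k v i ⟩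
    lincomb (rows k) (λ p → rows k p · v) i + lincomb (cols k) (λ q → cols k q · v) i
      ≡⟨ cong₂ _+_ (trans (lincomb-cong (rows k) rows⊥v i) (lincomb-0 (rows k) i))
                   (trans (lincomb-cong (cols k) cols⊥v i) (lincomb-0 (cols k) i)) ⟩
    0ℚ + 0ℚ
      ≡⟨ +-identityˡ 0ℚ ⟩
    0ℚ
      ∎
    where open ≡-Reasoning

  module Im k = OrthogonalBasis (gramSchmidt (cols k))
  module Coim k = OrthogonalBasis (gramSchmidt (rows k))

  imageDim : ℕ → ℕ
  imageDim k = Im.size k

  coimageDim : ℕ → ℕ
  coimageDim k = Coim.size k

  -- Degree k splits orthogonally into the image of d, the row space of d and the kernel of the Laplacian.
  hodge-dimension : (k b : ℕ) → IsKerDim (laplacian k) b → (imageDim k ℕ.+ coimageDim k) ℕ.+ b ≡ size k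
  hodge-dimension k b (B , B-kernel , B-independent , B-spanning) = basis-size (H ++ᶠ B)
    (++-independent H B H-orthogonal H-nonNull B-independent (λ i l → kernel⊥H (B l) (B-kernel l) i))
    (++-spanning H B H-orthogonal H-nonNull (λ u u⊥H → B-spanning u (⊥H⇒kernel u u⊥H)))
    where
    H = Im.basis k ++ᶠ Coim.basis k
    H-orthogonal : Orthogonal H
    H-orthogonal = ++-orthogonal (Im.basis k) (Coim.basis k) (Im.orthogonal k) (Coim.orthogonal k)
      (λ i j → span-⊥-span (cols k) (rows k) (λ q p → trans (·-comm (cols k q) (rows k p)) (rows⊥cols k p q))
                 (Im.within k i) (Coim.within k j))
    H-nonNull : NonNull H
    H-nonNull = ++-nonNull (Im.basis k) (Coim.basis k) (Im.nonNull k) (Coim.nonNull k)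
    kernel⊥H : ∀ v → InKernel (laplacian k) v → ∀ i → H i · v ≡ 0ℚ
    kernel⊥H v v∈ker =
      let rows⊥v , cols⊥v = kernel⇒⊥ k v v∈ker
      in ++-⊥ (Im.basis k) (Coim.basis k) (λ i → ∈Span-⊥ (cols k) v cols⊥v (Im.within k i))
                                          (λ j → ∈Span-⊥ (rows k) v rows⊥v (Coim.within k j))
    ⊥H⇒kernel : ∀ v → (∀ i → H i · v ≡ 0ℚ) → InKernel (laplacian k) v
    ⊥H⇒kernel v v⊥H =
      let Im⊥v , Coim⊥v = ++-⊥⁻ (Im.basis k) (Coim.basis k) v⊥H
      in ⊥⇒kernel k v (λ p → ∈Span-⊥ (Coim.basis k) v Coim⊥v (Coim.spans k p))
                      (λ q → ∈Span-⊥ (Im.basis k) v Im⊥v (Im.spans k q))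

  apply-d : (k : ℕ) → Vector ℚ (size k) → Vector ℚ (size (ℕ.suc k))
  apply-d k v p = rows k p · v

  apply-d-lincomb : (k : ℕ) {r : ℕ} (F : Family (size k) r) (c : Vector ℚ r) →
    apply-d k (lincomb F c) ≗ lincomb (apply-d k ∘ F) c
  apply-d-lincomb k F c p = begin
    rows k p · lincomb F c                 ≡⟨ ·-comm (rows k p) (lincomb F c) ⟩
    lincomb F c · rows k p                 ≡⟨ ·-lincombˡ F c (rows k p) ⟩
    sumFin (λ i → c i * (F i · rows k p))  ≡⟨ sumFin-cong (λ i → cong (c i *_) (·-comm (F i) (rows k p))) ⟩
    lincomb (apply-d k ∘ F) c p            ∎
    where open ≡-Reasoning

  apply-d≗lincomb-cols : (k : ℕ) (v : Vector ℚ (size k)) → apply-d k v ≗ lincomb (cols (ℕ.suc k)) v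
  apply-d≗lincomb-cols k v p = sumFin-cong (λ q → *-comm (d k p q) (v q))

  -- d maps an orthogonal basis of its row space to a basis of its image: row rank equals column rank.
  coimageDim≡imageDim : ∀ k → coimageDim k ≡ imageDim (ℕ.suc k)
  coimageDim≡imageDim k = independent-spanning-size X (Im.basis (ℕ.suc k))
    X-independent (orthogonal⇒independent (Im.basis (ℕ.suc k)) (Im.orthogonal (ℕ.suc k)) (Im.nonNull (ℕ.suc k)))
    (λ j → ∈Span-trans (Im.basis (ℕ.suc k)) (Coim.basis k j , apply-d≗lincomb-cols k (Coim.basis k j))
                        (Im.spans (ℕ.suc k)))
    Im⊆X
    where
    X : Family (size (ℕ.suc k)) (coimageDim k)
    X = apply-d k ∘ Coim.basis k
    X-independent : Independent X
    X-independent c Xc≗0 = orthogonal⇒independent (Coim.basis k) (Coim.orthogonal k) (Coim.nonNull k) c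
      (∈Span∧⊥⇒≗0 (rows k) (∈Span-trans (rows k) (∈Span-lincomb (Coim.basis k) c) (Coim.within k))
                  (λ p → trans (apply-d-lincomb k (Coim.basis k) c p) (Xc≗0 p)))
    -- d v only sees the component of v in the row space, which the coimage basis spans.
    Im⊆X : Im.basis (ℕ.suc k) ⊆Span X
    Im⊆X i = coordinate H₂ (Coim.nonNull k) v , λ p → begin
      Im.basis (ℕ.suc k) i p                ≡⟨ v-coordinates p ⟩
      lincomb (cols (ℕ.suc k)) v p          ≡⟨ sym (apply-d≗lincomb-cols k v p) ⟩
      rows k p · v                          ≡⟨ ·-congʳ (rows k p) (projection+residual H₂ (Coim.nonNull k) v) ⟩
      rows k p · (λ j → proj j + res j)     ≡⟨ ·-+ʳ (rows k p) proj res ⟩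
      rows k p · proj + rows k p · res      ≡⟨ cong (rows k p · proj +_) (rows⊥res p) ⟩
      rows k p · proj + 0ℚ                  ≡⟨ +-identityʳ (rows k p · proj) ⟩
      apply-d k proj p                      ≡⟨ apply-d-lincomb k H₂ (coordinate H₂ (Coim.nonNull k) v) p ⟩
      lincomb X (coordinate H₂ (Coim.nonNull k) v) p ∎
      where
      open ≡-Reasoning
      H₂ = Coim.basis k
      v = proj₁ (Im.within (ℕ.suc k) i)
      v-coordinates = proj₂ (Im.within (ℕ.suc k) i)
      proj = projection H₂ (Coim.nonNull k) v
      res = residual H₂ (Coim.nonNull k) v
      rows⊥res : ∀ p → rows k p · res ≡ 0ℚ
      rows⊥res p = ∈Span-⊥ H₂ res
        (λ j → trans (·-comm (H₂ j) res) (residual-⊥ H₂ (Coim.nonNull k) (Coim.orthogonal k) v j)) (Coim.spans k p)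

  imageDim-0 : imageDim 0 ≡ 0
  imageDim-0 = nonNull∧null⇒empty (Im.basis 0) (Im.nonNull 0) (λ i → proj₂ (Im.within 0 i))

  euler-poincaré : (N : ℕ) → size (ℕ.suc N) ≡ 0 → (b : ℕ → ℕ) → (∀ k → IsKerDim (laplacian k) (b k)) →
    altSum (ℕ.suc N) size ≡ altSum (ℕ.suc N) b
  euler-poincaré N top≡0 b kernelDim =
    altSum-telescope-vanishing imageDim b size size≡ (ℕ.suc N) imageDim-0
      (nonNull-in-ℚ⁰ top≡0 (Im.basis (ℕ.suc N)) (Im.nonNull (ℕ.suc N)))
    where
    size≡ : ∀ k → size k ≡ imageDim k ℕ.+ (imageDim (ℕ.suc k) ℕ.+ b k)
    size≡ k = begin
      size k
        ≡⟨ sym (hodge-dimension k (b k) (kernelDim k)) ⟩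
      (imageDim k ℕ.+ coimageDim k) ℕ.+ b k
        ≡⟨ ℕₚ.+-assoc (imageDim k) (coimageDim k) (b k) ⟩
      imageDim k ℕ.+ (coimageDim k ℕ.+ b k)
        ≡⟨ cong (λ x → imageDim k ℕ.+ (x ℕ.+ b k)) (coimageDim≡imageDim k) ⟩
      imageDim k ℕ.+ (imageDim (ℕ.suc k) ℕ.+ b k)
        ∎
      where open ≡-Reasoning

x∉p-x : {n : ℕ} (p : Subset n) (x : Fin n) → x ∉ p ∖ x
x∉p-x (_ ∷ p) zero    ()
x∉p-x (_ ∷ p) (suc x) (there x∈p-x) = x∉p-x p x x∈p-x

x∈p-y⇔x∈p : {n : ℕ} {p : Subset n} {x y : Fin n} → x ≢ y → x ∈ p ∖ y ⇔ x ∈ p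
x∈p-y⇔x∈p {p = p} {y = y} x≢y = mk⇔ (p─q⊆p p ⁅ y ⁆) (λ x∈p → x∈p∧x≢y⇒x∈p-y x∈p x≢y)

∣p∣≡1+∣p-x∣ : {n : ℕ} {p : Subset n} {x : Fin n} → x ∈ p → ∣ p ∣ ≡ ℕ.suc ∣ p ∖ x ∣
∣p∣≡1+∣p-x∣ {p = inside ∷ p} here = cong (ℕ.suc ∘ ∣_∣) (sym (p─⊥≡p p))
∣p∣≡1+∣p-x∣ {p = inside  ∷ p} (there x∈p) = cong ℕ.suc (∣p∣≡1+∣p-x∣ x∈p)
∣p∣≡1+∣p-x∣ {p = outside ∷ p} (there x∈p) = ∣p∣≡1+∣p-x∣ x∈p

dim-remove : {n : ℕ} {x : Subset n} {v u : Fin n} → v ∈ x → u ∈ x ∖ v → dim x ≡ ℕ.suc (dim (x ∖ v))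
dim-remove v∈x u∈x-v rewrite ∣p∣≡1+∣p-x∣ v∈x | ∣p∣≡1+∣p-x∣ u∈x-v = refl

eqS-refl : {n : ℕ} (x : Subset n) → eqS x x ≡ true
eqS-refl x = dec-true (≡-dec _≟ᵇ_ x x) refl

eqS-false : {n : ℕ} {x y : Subset n} → x ≢ y → eqS x y ≡ false
eqS-false {x = x} {y} = dec-false (≡-dec _≟ᵇ_ x y)

eqS-sym : {n : ℕ} (x y : Subset n) → eqS x y ≡ eqS y x
eqS-sym x y = does-⇔ (mk⇔ sym sym) (≡-dec _≟ᵇ_ x y) (≡-dec _≟ᵇ_ y x)

T-eqS⇒≡ : {n : ℕ} {x y : Subset n} → T (eqS x y) → x ≡ y
T-eqS⇒≡ {x = x} {y} = T-does⇒ (≡-dec _≟ᵇ_ x y)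

length-filterᵇ-tabulate-cong : {A : Set} {m : ℕ} (P Q : A → Bool) (f : Fin m → A) →
  (∀ t → P (f t) ≡ Q (f t)) → length (filterᵇ P (tabulate f)) ≡ length (filterᵇ Q (tabulate f))
length-filterᵇ-tabulate-cong {m = ℕ.zero}  P Q f P≗Q = refl
length-filterᵇ-tabulate-cong {m = ℕ.suc m} P Q f P≗Q rewrite P≗Q zero with Q (f zero)
... | true  = cong ℕ.suc (length-filterᵇ-tabulate-cong P Q (f ∘ suc) (P≗Q ∘ suc))
... | false = length-filterᵇ-tabulate-cong P Q (f ∘ suc) (P≗Q ∘ suc)

length-filterᵇ-tabulate-except : {A : Set} {m : ℕ} (P Q : A → Bool) (f : Fin m → A) (v : Fin m) →
  (∀ t → t ≢ v → P (f t) ≡ Q (f t)) → P (f v) ≡ true → Q (f v) ≡ false →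
  length (filterᵇ P (tabulate f)) ≡ ℕ.suc (length (filterᵇ Q (tabulate f)))
length-filterᵇ-tabulate-except P Q f zero    P≗Q Pv Qv rewrite Pv | Qv =
  cong ℕ.suc (length-filterᵇ-tabulate-cong P Q (f ∘ suc) (λ t → P≗Q (suc t) (λ ())))
length-filterᵇ-tabulate-except P Q f (suc v) P≗Q Pv Qv rewrite P≗Q zero (λ ()) with Q (f zero)
... | true  = cong ℕ.suc (length-filterᵇ-tabulate-except P Q (f ∘ suc) v
                (λ t t≢v → P≗Q (suc t) (t≢v ∘ suc-injective)) Pv Qv)
... | false = length-filterᵇ-tabulate-except P Q (f ∘ suc) v
                (λ t t≢v → P≗Q (suc t) (t≢v ∘ suc-injective)) Pv Qv

-- Both hold by computation: does (m <? k) unfolds to m <ᵇ k.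
<ᵇ-true : {m k : ℕ} → m ℕ.< k → (m ℕ.<ᵇ k) ≡ true
<ᵇ-true {m} {k} = dec-true (m ℕₚ.<? k)

<ᵇ-false : {m k : ℕ} → ¬ m ℕ.< k → (m ℕ.<ᵇ k) ≡ false
<ᵇ-false {m} {k} = dec-false (m ℕₚ.<? k)

∈?-∖ : {n : ℕ} (x : Subset n) {t v : Fin n} → t ≢ v → does (t ∈? x ∖ v) ≡ does (t ∈? x)
∈?-∖ x {t} {v} t≢v = does-⇔ (x∈p-y⇔x∈p t≢v) (t ∈? x ∖ v) (t ∈? x)

pos-∖-below : {n : ℕ} {x : Subset n} {v u : Fin n} → v ∈ x → v <ᶠ u → pos x u ≡ ℕ.suc (pos (x ∖ v) u)
pos-∖-below {x = x} {v} {u} v∈x v<u = length-filterᵇ-tabulate-except _ _ id v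
  (λ t t≢v → cong (_∧ (toℕ t ℕ.<ᵇ toℕ u)) (sym (∈?-∖ x t≢v)))
  (cong₂ _∧_ (dec-true (v ∈? x) v∈x) (<ᵇ-true v<u))
  (cong (_∧ (toℕ v ℕ.<ᵇ toℕ u)) (dec-false (v ∈? x ∖ v) (x∉p-x x v)))

pos-∖-above : {n : ℕ} {x : Subset n} {v u : Fin n} → u <ᶠ v → pos x u ≡ pos (x ∖ v) u
pos-∖-above {x = x} {v} {u} u<v = length-filterᵇ-tabulate-cong _ _ id agree
  where
  agree : ∀ t → (does (t ∈? x) ∧ (toℕ t ℕ.<ᵇ toℕ u)) ≡ (does (t ∈? x ∖ v) ∧ (toℕ t ℕ.<ᵇ toℕ u))
  agree t with t ≟ᶠ v
  ... | no  t≢v = cong (_∧ (toℕ t ℕ.<ᵇ toℕ u)) (sym (∈?-∖ x t≢v))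
  ... | yes refl rewrite <ᵇ-false (ℕₚ.<⇒≯ u<v) = trans (∧-zeroʳ _) (sym (∧-zeroʳ _))

sign : {n : ℕ} → Subset n → Fin n → ℚ
sign x v = sgn (pos x v)

-- Removing the smaller vertex v first moves u down one position; removing u first leaves v in place.
sign-swap-< : {n : ℕ} {x : Subset n} {v u : Fin n} → v ∈ x → v <ᶠ u →
  sign x v * sign (x ∖ v) u ≡ - (sign x u * sign (x ∖ u) v)
sign-swap-< {x = x} {v} {u} v∈x v<u = begin
  sign x v * sign (x ∖ v) u              ≡⟨ cong (λ k → sgn k * sign (x ∖ v) u) (pos-∖-above v<u) ⟩
  sign (x ∖ u) v * sign (x ∖ v) u        ≡⟨ solve (sign (x ∖ u) v) (sign (x ∖ v) u) ⟩
  - (- sign (x ∖ v) u * sign (x ∖ u) v)  ≡⟨ cong (λ k → - (sgn k * sign (x ∖ u) v)) (sym (pos-∖-below v∈x v<u)) ⟩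
  - (sign x u * sign (x ∖ u) v)          ∎
  where
  open ≡-Reasoning
  solve : ∀ a b → a * b ≡ - (- b * a)
  solve = solve-∀ ℚ-ring

sign-swap : {n : ℕ} {x : Subset n} {v u : Fin n} → v ∈ x → u ∈ x → v ≢ u →
  sign x v * sign (x ∖ v) u ≡ - (sign x u * sign (x ∖ u) v)
sign-swap {v = v} {u} v∈x u∈x v≢u with <ᶠ-cmp v u
... | tri< v<u _ _ = sign-swap-< v∈x v<u
... | tri≈ _ v≡u _ = ⊥-elim (v≢u v≡u)
... | tri> _ _ u<v = sym (⁻¹-selfInverse +-0-group (sym (sign-swap-< u∈x u<v)))

sumSubsets : {n : ℕ} → (Subset n → ℚ) → ℚ
sumSubsets {n} f = sumMap f (allSubsets n)

sumSubsets-single : {n : ℕ} (f : Subset n → ℚ) (a : Subset n) → (∀ z → z ≢ a → f z ≡ 0ℚ) → sumSubsets f ≡ f a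
sumSubsets-single {ℕ.zero}  f []      _   = +-identityʳ (f [])
sumSubsets-single {ℕ.suc n} f (b ∷ a) f≡0 = begin
  sumMap f (map (outside ∷_) (allSubsets n) ++ map (inside ∷_) (allSubsets n))
    ≡⟨ sumMap-++ f (map (outside ∷_) (allSubsets n)) (map (inside ∷_) (allSubsets n)) ⟩
  sumMap f (map (outside ∷_) (allSubsets n)) + sumMap f (map (inside ∷_) (allSubsets n))
    ≡⟨ cong₂ _+_ (sumMap-map f (outside ∷_) (allSubsets n)) (sumMap-map f (inside ∷_) (allSubsets n)) ⟩
  sumSubsets (f ∘ (outside ∷_)) + sumSubsets (f ∘ (inside ∷_))
    ≡⟨ halves b f≡0 ⟩
  f (b ∷ a)
    ∎
  where
  open ≡-Reasoning
  halves : (b : Bool) → (∀ z → z ≢ b ∷ a → f z ≡ 0ℚ) →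
    sumSubsets (f ∘ (outside ∷_)) + sumSubsets (f ∘ (inside ∷_)) ≡ f (b ∷ a)
  halves false f≡0 = trans (cong₂ _+_
    (sumSubsets-single (f ∘ (outside ∷_)) a (λ z z≢a → f≡0 (outside ∷ z) (z≢a ∘ ∷-injectiveʳ)))
    (sumMap-zero (allSubsets n) (λ z → f≡0 (inside ∷ z) (λ ()))))
    (+-identityʳ _)
  halves true  f≡0 = trans (cong₂ _+_
    (sumMap-zero (allSubsets n) (λ z → f≡0 (outside ∷ z) (λ ())))
    (sumSubsets-single (f ∘ (inside ∷_)) a (λ z z≢a → f≡0 (inside ∷ z) (z≢a ∘ ∷-injectiveʳ))))
    (+-identityˡ _)

sumSubsets-eqS : {n : ℕ} (a : Subset n) (g : Subset n → ℚ) → sumSubsets (λ z → ifᵇ (eqS a z) (g z)) ≡ g a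
sumSubsets-eqS a g = trans
  (sumSubsets-single (λ z → ifᵇ (eqS a z) (g z)) a (λ z z≢a → cong (λ c → ifᵇ c (g z)) (eqS-false (z≢a ∘ sym))))
  (cong (λ c → ifᵇ c (g a)) (eqS-refl a))

sumSubsets-𝟙ˡ : {n : ℕ} (a : Subset n) (g : Subset n → ℚ) → sumSubsets (λ z → 𝟙 (eqS a z) * g z) ≡ g a
sumSubsets-𝟙ˡ {n} a g = trans (sumMap-cong (allSubsets n) (λ z → sym (ifᵇ≡𝟙* (eqS a z) (g z)))) (sumSubsets-eqS a g)

sumSubsets-𝟙ʳ : {n : ℕ} (a : Subset n) (g : Subset n → ℚ) → sumSubsets (λ z → 𝟙 (eqS z a) * g z) ≡ g a
sumSubsets-𝟙ʳ {n} a g =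
  trans (sumMap-cong (allSubsets n) (λ z → cong (λ c → 𝟙 c * g z) (eqS-sym z a))) (sumSubsets-𝟙ˡ a g)

incidence : {n : ℕ} → Subset n → Subset n → ℚ
incidence x z = sumFin (λ v → ifᵇ (does (v ∈? x) ∧ eqS (x ∖ v) z) (sign x v))

removal-term : {n : ℕ} (x w : Subset n) → Fin n → Fin n → ℚ
removal-term x w v u = ifᵇ (does (v ∈? x)) (sign x v * ifᵇ (does (u ∈? x ∖ v) ∧ eqS (x ∖ v ∖ u) w) (sign (x ∖ v) u))

ifᵇ-antisymmetric : (a b e : Bool) (σ τ σ′ τ′ : ℚ) → (T a → T b → σ * τ ≡ - (σ′ * τ′)) →
  ifᵇ a (σ * ifᵇ (b ∧ e) τ) ≡ - ifᵇ b (σ′ * ifᵇ (a ∧ e) τ′)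
ifᵇ-antisymmetric false false e     σ τ σ′ τ′ _ = refl
ifᵇ-antisymmetric false true  e     σ τ σ′ τ′ _ = sym (cong -_ (*-zeroʳ σ′))
ifᵇ-antisymmetric true  false e     σ τ σ′ τ′ _ = *-zeroʳ σ
ifᵇ-antisymmetric true  true  false σ τ σ′ τ′ _ = trans (*-zeroʳ σ) (sym (cong -_ (*-zeroʳ σ′)))
ifᵇ-antisymmetric true  true  true  σ τ σ′ τ′ h = h _ _

removal-term-antisymmetric : {n : ℕ} (x w : Subset n) (v u : Fin n) → removal-term x w v u ≡ - removal-term x w u v
removal-term-antisymmetric x w v u with v ≟ᶠ u
... | yes refl rewrite dec-false (v ∈? x ∖ v) (x∉p-x x v) = trans vanishes (sym (cong -_ vanishes))
  where
  vanishes : ifᵇ (does (v ∈? x)) (sign x v * 0ℚ) ≡ 0ℚ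
  vanishes = trans (cong (ifᵇ (does (v ∈? x))) (*-zeroʳ (sign x v))) (ifᵇ-0 (does (v ∈? x)))
... | no  v≢u rewrite ∈?-∖ x (v≢u ∘ sym) | ∈?-∖ x v≢u | p─x─y≡p─y─x x v u =
  ifᵇ-antisymmetric (does (v ∈? x)) (does (u ∈? x)) (eqS (x ∖ u ∖ v) w)
    (sign x v) (sign (x ∖ v) u) (sign x u) (sign (x ∖ u) v)
    (λ v∈x u∈x → sign-swap (T-does⇒ (v ∈? x) v∈x) (T-does⇒ (u ∈? x) u∈x) v≢u)

incidence∘incidence : {n : ℕ} (x w : Subset n) → sumSubsets (λ z → incidence x z * incidence z w) ≡ 0ℚ
incidence∘incidence {n} x w = begin
  sumSubsets (λ z → incidence x z * incidence z w)
    ≡⟨ sumMap-cong (allSubsets n) (λ z → sym (sumFin-*ʳ (incidence z w) (term z))) ⟩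
  sumSubsets (λ z → sumFin (λ v → term z v * incidence z w))
    ≡⟨ sumMap-comm (λ z v → term z v * incidence z w) (allSubsets n) (allFin n) ⟩
  sumFin (λ v → sumSubsets (λ z → term z v * incidence z w))
    ≡⟨ sumFin-cong collapse ⟩
  sumFin (λ v → ifᵇ (does (v ∈? x)) (sign x v * incidence (x ∖ v) w))
    ≡⟨ sumFin-cong (λ v → cong (ifᵇ (does (v ∈? x))) (sym (sumFin-*ˡ (sign x v) (face (x ∖ v))))) ⟩
  sumFin (λ v → ifᵇ (does (v ∈? x)) (sumFin (λ u → sign x v * face (x ∖ v) u)))
    ≡⟨ sumFin-cong (λ v → sym (sumMap-ifᵇ (does (v ∈? x)) (λ u → sign x v * face (x ∖ v) u) (allFin n))) ⟩
  sumFin (λ v → sumFin (removal-term x w v))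
    ≡⟨ sumFin-antisymmetric (removal-term x w) (removal-term-antisymmetric x w) ⟩
  0ℚ
    ∎
  where
  open ≡-Reasoning
  term : Subset n → Fin n → ℚ
  term z v = ifᵇ (does (v ∈? x) ∧ eqS (x ∖ v) z) (sign x v)
  face : Subset n → Fin n → ℚ
  face y u = ifᵇ (does (u ∈? y) ∧ eqS (y ∖ u) w) (sign y u)
  collapse : ∀ v → sumSubsets (λ z → term z v * incidence z w) ≡ ifᵇ (does (v ∈? x)) (sign x v * incidence (x ∖ v) w)
  collapse v = begin
    sumSubsets (λ z → term z v * incidence z w)
      ≡⟨ sumMap-cong (allSubsets n) (λ z → ifᵇ-∧-* (does (v ∈? x)) (eqS (x ∖ v) z) (sign x v) (incidence z w)) ⟩
    sumSubsets (λ z → ifᵇ (eqS (x ∖ v) z) (ifᵇ (does (v ∈? x)) (sign x v) * incidence z w))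
      ≡⟨ sumSubsets-eqS (x ∖ v) (λ z → ifᵇ (does (v ∈? x)) (sign x v) * incidence z w) ⟩
    ifᵇ (does (v ∈? x)) (sign x v) * incidence (x ∖ v) w
      ≡⟨ ifᵇ-*ˡ (does (v ∈? x)) (sign x v) (incidence (x ∖ v) w) ⟩
    ifᵇ (does (v ∈? x)) (sign x v * incidence (x ∖ v) w)
      ∎

incidence≢0⇒facet : {n : ℕ} {x z : Subset n} → incidence x z ≢ 0ℚ → Σ (Fin n) λ v → v ∈ x × x ∖ v ≡ z
incidence≢0⇒facet {x = x} {z} incidence≢0 =
  let v , term≢0  = sumFin-≢0 (λ v → ifᵇ (does (v ∈? x) ∧ eqS (x ∖ v) z) (sign x v)) incidence≢0
      v∈x , x∖v≡z = Equivalence.to T-∧ (ifᵇ-≢0 (does (v ∈? x) ∧ eqS (x ∖ v) z) term≢0)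
  in v , T-does⇒ (v ∈? x) v∈x , T-does⇒ (≡-dec _≟ᵇ_ (x ∖ v) z) x∖v≡z

incidence≢0⇒sign : {n : ℕ} {x z : Subset n} → Nonempty z → incidence x z ≢ 0ℚ → sgn (dim x) ≡ - sgn (dim z)
incidence≢0⇒sign {x = x} {z} (u , u∈z) incidence≢0 with incidence≢0⇒facet {x = x} {z} incidence≢0
... | v , v∈x , refl = cong sgn (dim-remove v∈x u∈z)

dcoef-split : {n : ℕ} (x y z t : Subset n) →
  dcoef (x , y) (z , t) ≡ 𝟙 (eqS y t) * incidence x z + sgn (dim x) * (𝟙 (eqS x z) * incidence y t)
dcoef-split {n} x y z t = cong₂ (λ p q → p + sgn (dim x) * q)
  (begin
    sumFin (λ v → ifᵇ (does (v ∈? x) ∧ eqS (x ∖ v) z ∧ eqS y t) (sign x v))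
      ≡⟨ sumFin-cong (λ v → ifᵇ-∧∧ (does (v ∈? x)) (eqS (x ∖ v) z) (eqS y t) (sign x v)) ⟩
    sumFin (λ v → ifᵇ (eqS y t) (ifᵇ (does (v ∈? x) ∧ eqS (x ∖ v) z) (sign x v)))
      ≡⟨ sumMap-ifᵇ (eqS y t) (λ v → ifᵇ (does (v ∈? x) ∧ eqS (x ∖ v) z) (sign x v)) (allFin n) ⟩
    ifᵇ (eqS y t) (incidence x z)
      ≡⟨ ifᵇ≡𝟙* (eqS y t) (incidence x z) ⟩
    𝟙 (eqS y t) * incidence x z
      ∎)
  (begin
    sumFin (λ w → ifᵇ (does (w ∈? y) ∧ eqS x z ∧ eqS (y ∖ w) t) (sign y w))
      ≡⟨ sumFin-cong (λ w → ifᵇ-∧∧′ (does (w ∈? y)) (eqS x z) (eqS (y ∖ w) t) (sign y w)) ⟩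
    sumFin (λ w → ifᵇ (eqS x z) (ifᵇ (does (w ∈? y) ∧ eqS (y ∖ w) t) (sign y w)))
      ≡⟨ sumMap-ifᵇ (eqS x z) (λ w → ifᵇ (does (w ∈? y) ∧ eqS (y ∖ w) t) (sign y w)) (allFin n) ⟩
    ifᵇ (eqS x z) (incidence y t)
      ≡⟨ ifᵇ≡𝟙* (eqS x z) (incidence y t) ⟩
    𝟙 (eqS x z) * incidence y t
      ∎)
  where
  open ≡-Reasoning
  ifᵇ-∧∧ : (a b c : Bool) (q : ℚ) → ifᵇ (a ∧ b ∧ c) q ≡ ifᵇ c (ifᵇ (a ∧ b) q)
  ifᵇ-∧∧ false b     c q = sym (ifᵇ-0 c)
  ifᵇ-∧∧ true  false c q = sym (ifᵇ-0 c)
  ifᵇ-∧∧ true  true  c q = refl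
  ifᵇ-∧∧′ : (a c b : Bool) (q : ℚ) → ifᵇ (a ∧ c ∧ b) q ≡ ifᵇ c (ifᵇ (a ∧ b) q)
  ifᵇ-∧∧′ false c     b q = sym (ifᵇ-0 c)
  ifᵇ-∧∧′ true  false b q = refl
  ifᵇ-∧∧′ true  true  b q = refl

module PairBoundary {n : ℕ} (x y x₂ y₂ : Subset n) where

  private
    ∂ : Subset n → Subset n → ℚ
    ∂ = incidence
    σ : Subset n → ℚ
    σ a = sgn (dim a)
    I : Subset n → Subset n → ℚ
    I a b = 𝟙 (eqS a b)

  -- With d (x , y) (z , t) = 𝟙 (y = t) ∂ x z + σ x 𝟙 (x = z) ∂ y t, the square of d has four parts: the two
  -- pure ones vanish by incidence∘incidence, the two mixed ones cancel since σ changes sign along a facet.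
  d∘d-summed-over-t : (z : Subset n) →
    sumSubsets (λ t → dcoef (x , y) (z , t) * dcoef (z , t) (x₂ , y₂))
      ≡ (I y y₂ * (∂ x z * ∂ z x₂) + I z x₂ * (σ z * ∂ x z * ∂ y y₂)) + I x z * (σ x * ∂ y y₂ * ∂ z x₂)
  d∘d-summed-over-t z = begin
    sumSubsets (λ t → dcoef (x , y) (z , t) * dcoef (z , t) (x₂ , y₂))
      ≡⟨ sumMap-cong (allSubsets n) (λ t → trans (cong₂ _*_ (dcoef-split x y z t) (dcoef-split z t x₂ y₂))
           (expand (I y t) (∂ x z) (σ x) (I x z) (∂ y t) (I t y₂) (∂ z x₂) (σ z) (I z x₂) (∂ t y₂))) ⟩
    sumSubsets (λ t → ((T₁ t + T₂ t) + T₃ t) + T₄ t)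
      ≡⟨ sumMap-+ (λ t → (T₁ t + T₂ t) + T₃ t) T₄ (allSubsets n) ⟩
    sumSubsets (λ t → (T₁ t + T₂ t) + T₃ t) + sumSubsets T₄
      ≡⟨ cong (_+ sumSubsets T₄) (trans (sumMap-+ (λ t → T₁ t + T₂ t) T₃ (allSubsets n))
                                        (cong (_+ sumSubsets T₃) (sumMap-+ T₁ T₂ (allSubsets n)))) ⟩
    ((sumSubsets T₁ + sumSubsets T₂) + sumSubsets T₃) + sumSubsets T₄
      ≡⟨ cong₂ _+_ (cong₂ _+_ (cong₂ _+_ ΣT₁ ΣT₂) ΣT₃) ΣT₄ ⟩
    ((I y y₂ * (∂ x z * ∂ z x₂) + I z x₂ * (σ z * ∂ x z * ∂ y y₂)) + I x z * (σ x * ∂ y y₂ * ∂ z x₂)) + 0ℚ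
      ≡⟨ +-identityʳ _ ⟩
    (I y y₂ * (∂ x z * ∂ z x₂) + I z x₂ * (σ z * ∂ x z * ∂ y y₂)) + I x z * (σ x * ∂ y y₂ * ∂ z x₂)
      ∎
    where
    open ≡-Reasoning
    T₁ T₂ T₃ T₄ : Subset n → ℚ
    T₁ t = I y t * (I t y₂ * (∂ x z * ∂ z x₂))
    T₂ t = I y t * (I z x₂ * (σ z * ∂ x z * ∂ t y₂))
    T₃ t = I x z * (I t y₂ * (σ x * ∂ y t * ∂ z x₂))
    T₄ t = (I x z * I z x₂ * σ x * σ z) * (∂ y t * ∂ t y₂)
    expand : ∀ Iyt ∂xz σx Ixz ∂yt Ity₂ ∂zx₂ σz Izx₂ ∂ty₂ →
      (Iyt * ∂xz + σx * (Ixz * ∂yt)) * (Ity₂ * ∂zx₂ + σz * (Izx₂ * ∂ty₂))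
        ≡ ((Iyt * (Ity₂ * (∂xz * ∂zx₂)) + Iyt * (Izx₂ * (σz * ∂xz * ∂ty₂)))
            + Ixz * (Ity₂ * (σx * ∂yt * ∂zx₂))) + (Ixz * Izx₂ * σx * σz) * (∂yt * ∂ty₂)
    expand = solve-∀ ℚ-ring
    ΣT₁ = sumSubsets-𝟙ˡ y (λ t → I t y₂ * (∂ x z * ∂ z x₂))
    ΣT₂ = sumSubsets-𝟙ˡ y (λ t → I z x₂ * (σ z * ∂ x z * ∂ t y₂))
    ΣT₃ = trans (sumMap-*ˡ (I x z) (λ t → I t y₂ * (σ x * ∂ y t * ∂ z x₂)) (allSubsets n))
                (cong (I x z *_) (sumSubsets-𝟙ʳ y₂ (λ t → σ x * ∂ y t * ∂ z x₂)))
    ΣT₄ = trans (sumMap-*ˡ c (λ t → ∂ y t * ∂ t y₂) (allSubsets n))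
                (trans (cong (c *_) (incidence∘incidence y y₂)) (*-zeroʳ c))
      where c = I x z * I z x₂ * σ x * σ z

  pair-d∘d : Nonempty x₂ → sumMap (λ r → dcoef (x , y) r * dcoef r (x₂ , y₂)) (allPairs n) ≡ 0ℚ
  pair-d∘d x₂≢∅ = begin
    sumMap (λ r → dcoef (x , y) r * dcoef r (x₂ , y₂)) (allPairs n)
      ≡⟨ sumMap-cartesianProduct (λ r → dcoef (x , y) r * dcoef r (x₂ , y₂)) (allSubsets n) (allSubsets n) ⟩
    sumSubsets (λ z → sumSubsets (λ t → dcoef (x , y) (z , t) * dcoef (z , t) (x₂ , y₂)))
      ≡⟨ sumMap-cong (allSubsets n) d∘d-summed-over-t ⟩
    sumSubsets (λ z → (S₁ z + S₂ z) + S₃ z)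
      ≡⟨ trans (sumMap-+ (λ z → S₁ z + S₂ z) S₃ (allSubsets n))
               (cong (_+ sumSubsets S₃) (sumMap-+ S₁ S₂ (allSubsets n))) ⟩
    (sumSubsets S₁ + sumSubsets S₂) + sumSubsets S₃
      ≡⟨ cong₂ _+_ (cong₂ _+_ ΣS₁ (sumSubsets-𝟙ʳ x₂ (λ z → σ z * ∂ x z * ∂ y y₂)))
                   (sumSubsets-𝟙ˡ x (λ z → σ x * ∂ y y₂ * ∂ z x₂)) ⟩
    (0ℚ + σ x₂ * ∂ x x₂ * ∂ y y₂) + σ x * ∂ y y₂ * ∂ x x₂
      ≡⟨ cancel (∂ x x₂ ≟ 0ℚ) ⟩
    0ℚ
      ∎
    where
    open ≡-Reasoning
    S₁ S₂ S₃ : Subset n → ℚ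
    S₁ z = I y y₂ * (∂ x z * ∂ z x₂)
    S₂ z = I z x₂ * (σ z * ∂ x z * ∂ y y₂)
    S₃ z = I x z * (σ x * ∂ y y₂ * ∂ z x₂)
    ΣS₁ : sumSubsets S₁ ≡ 0ℚ
    ΣS₁ = trans (sumMap-*ˡ (I y y₂) (λ z → ∂ x z * ∂ z x₂) (allSubsets n))
                (trans (cong (I y y₂ *_) (incidence∘incidence x x₂)) (*-zeroʳ (I y y₂)))
    cancel : Dec (∂ x x₂ ≡ 0ℚ) → (0ℚ + σ x₂ * ∂ x x₂ * ∂ y y₂) + σ x * ∂ y y₂ * ∂ x x₂ ≡ 0ℚ
    cancel (yes ∂xx₂≡0) rewrite ∂xx₂≡0 = vanish (σ x₂) (∂ y y₂) (σ x)
      where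
      vanish : ∀ a b c → (0ℚ + a * 0ℚ * b) + c * b * 0ℚ ≡ 0ℚ
      vanish = solve-∀ ℚ-ring
    cancel (no ∂xx₂≢0) rewrite incidence≢0⇒sign x₂≢∅ ∂xx₂≢0 = opposite (σ x₂) (∂ x x₂) (∂ y y₂)
      where
      opposite : ∀ s a b → (0ℚ + s * a * b) + (- s) * b * a ≡ 0ℚ
      opposite = solve-∀ ℚ-ring

deg : {n : ℕ} → Pair n → ℕ
deg (x , y) = dim x ℕ.+ dim y

data Facet {n : ℕ} : Pair n → Pair n → Set where
  left  : ∀ {x y v} → v ∈ x → Facet (x , y) (x ∖ v , y)
  right : ∀ {x y w} → w ∈ y → Facet (x , y) (x , y ∖ w)

dcoef≢0⇒Facet : {n : ℕ} (p r : Pair n) → dcoef p r ≢ 0ℚ → Facet p r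
dcoef≢0⇒Facet (x , y) (z , t) dcoef≢0 with 𝟙 (eqS y t) * incidence x z ≟ 0ℚ
... | no first≢0 =
  let y≡t , incidence≢0 = p*q≢0⇒p≢0×q≢0 (𝟙 (eqS y t)) (incidence x z) first≢0
      v , v∈x , x∖v≡z  = incidence≢0⇒facet incidence≢0
  in subst₂ (λ z t → Facet (x , y) (z , t)) x∖v≡z (T-eqS⇒≡ (ifᵇ-≢0 (eqS y t) y≡t)) (left v∈x)
... | yes first≡0 =
  let x≡z , incidence≢0 =
        p*q≢0⇒p≢0×q≢0 (𝟙 (eqS x z)) (incidence y t) (proj₂ (p*q≢0⇒p≢0×q≢0 (sgn (dim x)) _ second≢0))
      w , w∈y , y∖w≡t  = incidence≢0⇒facet incidence≢0
  in subst₂ (λ z t → Facet (x , y) (z , t)) (T-eqS⇒≡ (ifᵇ-≢0 (eqS x z) x≡z)) y∖w≡t (right w∈y)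
  where
  second≢0 : sgn (dim x) * (𝟙 (eqS x z) * incidence y t) ≢ 0ℚ
  second≢0 second≡0 = dcoef≢0 (trans (dcoef-split x y z t) (trans (cong₂ _+_ first≡0 second≡0) (+-identityˡ 0ℚ)))

Facet⇒⊆ : {n : ℕ} {x y z t : Subset n} → Facet (x , y) (z , t) → z ⊆ x × t ⊆ y
Facet⇒⊆ {x = x} (left  {v = v} _) = p─q⊆p x ⁅ v ⁆ , id
Facet⇒⊆ {y = y} (right {w = w} _) = id , p─q⊆p y ⁅ w ⁆

Facet⇒deg : {n : ℕ} {p : Pair n} {z t : Subset n} → Facet p (z , t) → Nonempty z → Nonempty t →
  deg p ≡ ℕ.suc (deg (z , t))
Facet⇒deg {p = x , y} (left  v∈x) (u , u∈z) _ = cong (ℕ._+ dim y) (dim-remove v∈x u∈z)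
Facet⇒deg {p = x , y} (right w∈y) _ (u , u∈t) =
  trans (cong (dim x ℕ.+_) (dim-remove w∈y u∈t)) (ℕₚ.+-suc (dim x) _)

record ConvexPairSet (n : ℕ) : Set where
  field
    member   : Pair n → Bool
    nonempty : ∀ {x y} → T (member (x , y)) → Nonempty x × Nonempty y
    convex   : ∀ {x y x₂ y₂ z t} → T (member (x , y)) → T (member (x₂ , y₂)) →
               x₂ ⊆ z → z ⊆ x → y₂ ⊆ t → t ⊆ y → T (member (z , t))

module PairComplex {n : ℕ} (S : ConvexPairSet n) where

  open ConvexPairSet S

  Λs : List (Pair n)
  Λs = filterᵇ member (allPairs n)

  pair : (k : ℕ) → Fin (fk Λs k) → Pair n
  pair k = lookup (kPairs Λs k)

  pair-member×deg : (k : ℕ) (i : Fin (fk Λs k)) → T (member (pair k i)) × deg (pair k i) ≡ k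
  pair-member×deg k i =
    let ∈Λs , k-pair = ∈-filter⁻ (T? ∘ isKpair k) (∈-lookup {xs = kPairs Λs k} i)
    in proj₂ (∈-filter⁻ (T? ∘ member) {xs = allPairs n} ∈Λs) , ≡ᵇ⇒≡ (deg (pair k i)) k k-pair

  dcoef-vanishes : (p r : Pair n) → T (member r) → deg p ≢ ℕ.suc (deg r) → dcoef p r ≡ 0ℚ
  dcoef-vanishes p r r∈Λ wrong-deg with dcoef p r ≟ 0ℚ
  ... | yes dcoef≡0 = dcoef≡0
  ... | no  dcoef≢0 =
    let z≠∅ , t≠∅ = nonempty r∈Λ in ⊥-elim (wrong-deg (Facet⇒deg (dcoef≢0⇒Facet p r dcoef≢0) z≠∅ t≠∅))

  dcoef-outside : (p r q : Pair n) → T (member p) → T (member q) → ¬ T (member r) → dcoef p r * dcoef r q ≡ 0ℚ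
  dcoef-outside p r q p∈Λ q∈Λ r∉Λ with dcoef p r ≟ 0ℚ | dcoef r q ≟ 0ℚ
  ... | yes pr≡0 | _        = trans (cong (_* dcoef r q) pr≡0) (*-zeroˡ (dcoef r q))
  ... | no  _    | yes rq≡0 = trans (cong (dcoef p r *_) rq≡0) (*-zeroʳ (dcoef p r))
  ... | no  pr≢0 | no  rq≢0 =
    let z⊆x , t⊆y   = Facet⇒⊆ (dcoef≢0⇒Facet p r pr≢0)
        x₂⊆z , y₂⊆t = Facet⇒⊆ (dcoef≢0⇒Facet r q rq≢0)
    in ⊥-elim (r∉Λ (convex p∈Λ q∈Λ x₂⊆z z⊆x y₂⊆t t⊆y))

  complex : CochainComplex
  complex = record
    { size = fk Λs
    ; d    = λ k p i → dcoef (pair (ℕ.suc k) p) (pair k i)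
    ; d∘d  = d∘d
    }
    where
    d∘d : ∀ k p j →
      sumFin (λ l → dcoef (pair (ℕ.suc (ℕ.suc k)) p) (pair (ℕ.suc k) l) * dcoef (pair (ℕ.suc k) l) (pair k j)) ≡ 0ℚ
    d∘d k p j = begin
      sumFin (g ∘ pair (ℕ.suc k))
        ≡⟨ sumFin-lookup g (kPairs Λs (ℕ.suc k)) ⟩
      sumMap g (kPairs Λs (ℕ.suc k))
        ≡⟨ sumMap-filterᵇ (isKpair (ℕ.suc k)) g Λs ⟩
      sumMap (λ r → ifᵇ (isKpair (ℕ.suc k) r) (g r)) Λs
        ≡⟨ sumMap-filterᵇ-cong member (allPairs n) degree-filter ⟩
      sumMap g Λs
        ≡⟨ sumMap-filterᵇ member g (allPairs n) ⟩
      sumMap (λ r → ifᵇ (member r) (g r)) (allPairs n)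
        ≡⟨ sumMap-cong (allPairs n) member-filter ⟩
      sumMap g (allPairs n)
        ≡⟨ PairBoundary.pair-d∘d (proj₁ P) (proj₂ P) (proj₁ Q) (proj₂ Q) (proj₁ (nonempty Q∈Λ)) ⟩
      0ℚ
        ∎
      where
      open ≡-Reasoning
      P = pair (ℕ.suc (ℕ.suc k)) p
      Q = pair k j
      P∈Λ = proj₁ (pair-member×deg (ℕ.suc (ℕ.suc k)) p)
      Q∈Λ = proj₁ (pair-member×deg k j)
      g : Pair n → ℚ
      g r = dcoef P r * dcoef r Q
      degree-filter : ∀ r → T (member r) → ifᵇ (isKpair (ℕ.suc k) r) (g r) ≡ g r
      degree-filter r r∈Λ with T? (isKpair (ℕ.suc k) r)
      ... | yes deg-r = ifᵇ-T deg-r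
      ... | no ¬deg-r = trans (ifᵇ-¬T ¬deg-r)
        (sym (trans (cong (_* dcoef r Q) (dcoef-vanishes P r r∈Λ wrong-deg)) (*-zeroˡ (dcoef r Q))))
        where
        wrong-deg : deg P ≢ ℕ.suc (deg r)
        wrong-deg e = ¬deg-r (ℕₚ.≡⇒≡ᵇ (deg r) (ℕ.suc k)
          (ℕₚ.suc-injective (trans (sym e) (proj₂ (pair-member×deg (ℕ.suc (ℕ.suc k)) p)))))
      member-filter : ∀ r → ifᵇ (member r) (g r) ≡ g r
      member-filter r with T? (member r)
      ... | yes r∈Λ = ifᵇ-T r∈Λ
      ... | no  r∉Λ = trans (ifᵇ-¬T r∉Λ) (sym (dcoef-outside P r Q P∈Λ Q∈Λ r∉Λ))

  open Hodge complex using (laplacian; d⁻; euler-poincaré)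

  isKpair⁻ : ℕ → Pair n → Bool
  isKpair⁻ ℕ.zero    r = false
  isKpair⁻ (ℕ.suc k) r = isKpair k r

  isKpair⁻-sound : ∀ k {r} → T (isKpair⁻ k r) → k ≡ ℕ.suc (deg r)
  isKpair⁻-sound (ℕ.suc k) {r} below-k = cong ℕ.suc (sym (≡ᵇ⇒≡ (deg r) k below-k))

  isKpair⁻-complete : ∀ k r → k ≡ ℕ.suc (deg r) → T (isKpair⁻ k r)
  isKpair⁻-complete (ℕ.suc k) r k≡ = ℕₚ.≡⇒≡ᵇ (deg r) k (sym (ℕₚ.suc-injective k≡))

  D-product : (k : ℕ) (p q r : Pair n) → T (member p) → T (member q) → T (member r) → deg p ≡ k → deg q ≡ k →
    Dcoef p r * Dcoef r q
      ≡ ifᵇ (isKpair (ℕ.suc k) r) (dcoef r p * dcoef r q) + ifᵇ (isKpair⁻ k r) (dcoef p r * dcoef q r)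
  D-product k p q r p∈Λ q∈Λ r∈Λ deg-p deg-q with T? (isKpair (ℕ.suc k) r) | T? (isKpair⁻ k r)
  ... | yes up | yes down =
    ⊥-elim (ℕₚ.m≢1+n+m k {1} (trans (isKpair⁻-sound k down) (cong ℕ.suc (≡ᵇ⇒≡ (deg r) (ℕ.suc k) up))))
  ... | yes up | no ¬down = begin
    Dcoef p r * Dcoef r q
      ≡⟨ cong₂ (λ a b → (a + dcoef r p) * (dcoef r q + b)) (above p deg-p) (above q deg-q) ⟩
    (0ℚ + dcoef r p) * (dcoef r q + 0ℚ)
      ≡⟨ solve (dcoef r p) (dcoef r q) ⟩
    dcoef r p * dcoef r q + 0ℚ
      ≡⟨ cong₂ _+_ (ifᵇ-T up) (ifᵇ-¬T ¬down) ⟨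
    _
      ∎
    where
    open ≡-Reasoning
    solve : ∀ a b → (0ℚ + a) * (b + 0ℚ) ≡ a * b + 0ℚ
    solve = solve-∀ ℚ-ring
    above : ∀ s → deg s ≡ k → dcoef s r ≡ 0ℚ
    above s deg-s = dcoef-vanishes s r r∈Λ (λ e → ℕₚ.m≢1+n+m k {1}
      (trans (sym deg-s) (trans e (cong ℕ.suc (≡ᵇ⇒≡ (deg r) (ℕ.suc k) up)))))
  ... | no ¬up | yes down = begin
    Dcoef p r * Dcoef r q
      ≡⟨ cong₂ (λ a b → (dcoef p r + a) * (b + dcoef q r)) (below p p∈Λ deg-p) (below q q∈Λ deg-q) ⟩
    (dcoef p r + 0ℚ) * (0ℚ + dcoef q r)
      ≡⟨ solve (dcoef p r) (dcoef q r) ⟩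
    0ℚ + dcoef p r * dcoef q r
      ≡⟨ cong₂ _+_ (ifᵇ-¬T ¬up) (ifᵇ-T down) ⟨
    _
      ∎
    where
    open ≡-Reasoning
    solve : ∀ a b → (a + 0ℚ) * (0ℚ + b) ≡ 0ℚ + a * b
    solve = solve-∀ ℚ-ring
    below : ∀ s → T (member s) → deg s ≡ k → dcoef r s ≡ 0ℚ
    below s s∈Λ deg-s = dcoef-vanishes r s s∈Λ (λ e → ℕₚ.m≢1+n+m (deg r) {1}
      (trans e (cong ℕ.suc (trans deg-s (isKpair⁻-sound k down)))))
  ... | no ¬up | no ¬down = begin
    Dcoef p r * Dcoef r q                ≡⟨ cong (_* Dcoef r q) (cong₂ _+_ p→r≡0 r→p≡0) ⟩
    (0ℚ + 0ℚ) * Dcoef r q                ≡⟨ *-zeroˡ (Dcoef r q) ⟩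
    0ℚ + 0ℚ                              ≡⟨ cong₂ _+_ (ifᵇ-¬T ¬up) (ifᵇ-¬T ¬down) ⟨
    _                                    ∎
    where
    open ≡-Reasoning
    p→r≡0 = dcoef-vanishes p r r∈Λ (λ e → ¬down (isKpair⁻-complete k r (trans (sym deg-p) e)))
    r→p≡0 = dcoef-vanishes r p p∈Λ (λ e → ¬up (ℕₚ.≡⇒≡ᵇ (deg r) (ℕ.suc k) (trans e (cong ℕ.suc deg-p))))

  isKpair⁻-sum : ∀ k i j →
    sumMap (λ r → ifᵇ (isKpair⁻ k r) (dcoef (pair k i) r * dcoef (pair k j) r)) Λs
      ≡ sumFin (λ l → d⁻ k i l * d⁻ k j l)
  isKpair⁻-sum ℕ.zero    i j = sumMap-zero Λs (λ _ → refl)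
  isKpair⁻-sum (ℕ.suc k) i j = trans (sym (sumMap-filterᵇ (isKpair k) h Λs)) (sym (sumFin-lookup h (kPairs Λs k)))
    where
    h : Pair n → ℚ
    h r = dcoef (pair (ℕ.suc k) i) r * dcoef (pair (ℕ.suc k) j) r

  Lblock≡laplacian : ∀ k i j → Lblock Λs k i j ≡ laplacian k i j
  Lblock≡laplacian k i j = begin
    sumMap (λ r → Dcoef p r * Dcoef r q) Λs
      ≡⟨ sumMap-filterᵇ-cong member (allPairs n) (λ r r∈Λ → D-product k p q r p∈Λ q∈Λ r∈Λ deg-p deg-q) ⟩
    sumMap (λ r → up r + down r) Λs
      ≡⟨ sumMap-+ up down Λs ⟩
    sumMap up Λs + sumMap down Λs
      ≡⟨ cong (_+ sumMap down Λs) (sumMap-filterᵇ (isKpair (ℕ.suc k)) from-above Λs) ⟨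
    sumMap from-above (kPairs Λs (ℕ.suc k)) + sumMap down Λs
      ≡⟨ cong₂ _+_ (sumFin-lookup from-above (kPairs Λs (ℕ.suc k))) (sym (isKpair⁻-sum k i j)) ⟨
    laplacian k i j
      ∎
    where
    open ≡-Reasoning
    p = pair k i
    q = pair k j
    p∈Λ = proj₁ (pair-member×deg k i)
    q∈Λ = proj₁ (pair-member×deg k j)
    deg-p = proj₂ (pair-member×deg k i)
    deg-q = proj₂ (pair-member×deg k j)
    from-above : Pair n → ℚ
    from-above r = dcoef r p * dcoef r q
    up down : Pair n → ℚ
    up r = ifᵇ (isKpair (ℕ.suc k) r) (from-above r)
    down r = ifᵇ (isKpair⁻ k r) (dcoef p r * dcoef q r)

  top-degree-empty : fk Λs (ℕ.suc (2 ℕ.* n)) ≡ 0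
  top-degree-empty = cong length (filter-none (T? ∘ isKpair (ℕ.suc (2 ℕ.* n))) (All.universal too-large Λs))
    where
    dim≤n : (x : Subset n) → dim x ℕ.≤ n
    dim≤n x = ℕₚ.≤-trans (ℕₚ.m∸n≤m ∣ x ∣ 1) (∣p∣≤n x)
    too-large : (r : Pair n) → ¬ T (isKpair (ℕ.suc (2 ℕ.* n)) r)
    too-large (x , y) deg≡ = ℕₚ.<-irrefl refl (begin-strict
      ℕ.suc (2 ℕ.* n)      ≡⟨ sym (≡ᵇ⇒≡ (deg (x , y)) _ deg≡) ⟩
      dim x ℕ.+ dim y      ≤⟨ ℕₚ.+-mono-≤ (dim≤n x) (dim≤n y) ⟩
      n ℕ.+ n              ≡⟨ cong (n ℕ.+_) (sym (ℕₚ.+-identityʳ n)) ⟩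
      2 ℕ.* n              <⟨ ℕₚ.n<1+n (2 ℕ.* n) ⟩
      ℕ.suc (2 ℕ.* n)      ∎)
      where open ℕₚ.≤-Reasoning

  euler-poincaré-pairs : (b : ℕ → ℕ) → ((k : ℕ) → IsKerDim (Lblock Λs k) (b k)) →
    altSum (ℕ.suc (2 ℕ.* n)) (fk Λs) ≡ altSum (ℕ.suc (2 ℕ.* n)) b
  euler-poincaré-pairs b kernelDim =
    euler-poincaré (2 ℕ.* n) top-degree-empty b (λ k → IsKerDim-cong (Lblock≡laplacian k) (kernelDim k))

module _ {n : ℕ} where

  Convex : (Subset n → Bool) → Set
  Convex S = ∀ {a b c} → T (S a) → T (S c) → a ⊆ b → b ⊆ c → T (S b)

  ∩-mono-⊆ : {a b c d : Subset n} → a ⊆ b → c ⊆ d → a ∩ c ⊆ b ∩ d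
  ∩-mono-⊆ {a} {c = c} a⊆b c⊆d u∈a∩c = let u∈a , u∈c = x∈p∩q⁻ a c u∈a∩c in x∈p∩q⁺ (a⊆b u∈a , c⊆d u∈c)

  pair-nonempty : {A B C : Subset n → Bool} → (∀ {x} → T (A x) → Nonempty x) → (∀ {y} → T (B y) → Nonempty y) →
    ∀ {x y} → T (A x ∧ B y ∧ C (x ∩ y)) → Nonempty x × Nonempty y
  pair-nonempty {A} A≠∅ B≠∅ {x} xy∈ =
    let x∈A , rest = Equivalence.to (T-∧ {A x}) xy∈ in A≠∅ x∈A , B≠∅ (proj₁ (Equivalence.to T-∧ rest))

  pair-convex : {A B C : Subset n → Bool} → Convex A → Convex B → Convex C →
    ∀ {x y x₂ y₂ z t} → T (A x ∧ B y ∧ C (x ∩ y)) → T (A x₂ ∧ B y₂ ∧ C (x₂ ∩ y₂)) →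
    x₂ ⊆ z → z ⊆ x → y₂ ⊆ t → t ⊆ y → T (A z ∧ B t ∧ C (z ∩ t))
  pair-convex {A} {B} {C} A-convex B-convex C-convex xy∈ x₂y₂∈ x₂⊆z z⊆x y₂⊆t t⊆y =
    let x∈A  , y∈B  , ∩∈C  = split xy∈
        x₂∈A , y₂∈B , ∩₂∈C = split x₂y₂∈
    in Equivalence.from T-∧ (A-convex x₂∈A x∈A x₂⊆z z⊆x , Equivalence.from T-∧
         (B-convex y₂∈B y∈B y₂⊆t t⊆y , C-convex ∩₂∈C ∩∈C (∩-mono-⊆ x₂⊆z y₂⊆t) (∩-mono-⊆ z⊆x t⊆y)))
    where
    split : ∀ {a b} → T (A a ∧ B b ∧ C (a ∩ b)) → T (A a) × T (B b) × T (C (a ∩ b))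
    split {a} ab∈ = let a∈A , rest = Equivalence.to (T-∧ {A a}) ab∈ in a∈A , Equivalence.to T-∧ rest

  T-nonemptyᵇ : {x : Subset n} → T (nonemptyᵇ x) ⇔ Nonempty x
  T-nonemptyᵇ {x} = mk⇔ (T-does⇒ (nonempty? x)) (Equivalence.from T-≡ ∘ dec-true (nonempty? x))

  nonemptyᵇ-convex : Convex nonemptyᵇ
  nonemptyᵇ-convex a≠∅ _ a⊆b _ =
    let u , u∈a = Equivalence.to T-nonemptyᵇ a≠∅ in Equivalence.from T-nonemptyᵇ (u , a⊆b u∈a)

  module _ {G : Subset n → Bool} (G-complex : IsComplex G) where

    complex-nonempty : ∀ {x} → T (G x) → Nonempty x
    complex-nonempty {x} x∈G = proj₁ G-complex x (Equivalence.to T-≡ x∈G)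

    complex-down : ∀ {a b} → T (G b) → a ⊆ b → Nonempty a → T (G a)
    complex-down {a} {b} b∈G a⊆b a≠∅ = Equivalence.from T-≡ (proj₂ G-complex b a (Equivalence.to T-≡ b∈G) a⊆b a≠∅)

    complex-convex : Convex G
    complex-convex a∈G c∈G a⊆b b⊆c = let u , u∈a = complex-nonempty a∈G in complex-down c∈G b⊆c (u , a⊆b u∈a)

  module _ {G K : Subset n → Bool} (G-complex : IsComplex G) (K-subcomplex : IsSubcomplex K G) where

    difference-nonempty : ∀ {x} → T (diffC G K x) → Nonempty x
    difference-nonempty {x} x∈U = complex-nonempty G-complex (proj₁ (Equivalence.to (T-∧ {G x}) x∈U))

    difference-convex : Convex (diffC G K)
    difference-convex {a} {c = c} a∈U c∈U a⊆b b⊆c =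
      let a∈G , a∉K = Equivalence.to (T-∧ {G a}) a∈U
          c∈G , _   = Equivalence.to (T-∧ {G c}) c∈U
      in Equivalence.from T-∧ (complex-convex G-complex a∈G c∈G a⊆b b⊆c ,
           Equivalence.from T-not⇔¬T (λ b∈K → Equivalence.to T-not⇔¬T a∉K
             (complex-down (proj₂ K-subcomplex) b∈K a⊆b (complex-nonempty G-complex a∈G))))

Λ-convex : {n : ℕ} (G K : Subset n → Bool) → IsComplex G → IsSubcomplex K G → LambdaKind → ConvexPairSet n
Λ-convex G K G-complex K-subcomplex κ = record { member = inΛ G K κ ; nonempty = nonempty κ ; convex = convex κ }
  where
  G≠∅ : ∀ {x} → T (G x) → Nonempty x
  G≠∅ = complex-nonempty G-complex
  K≠∅ : ∀ {x} → T (K x) → Nonempty x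
  K≠∅ = complex-nonempty (proj₂ K-subcomplex)
  U≠∅ : ∀ {x} → T (diffC G K x) → Nonempty x
  U≠∅ = difference-nonempty G-complex K-subcomplex
  G-convex : Convex G
  G-convex = complex-convex G-complex
  K-convex : Convex K
  K-convex = complex-convex (proj₂ K-subcomplex)
  U-convex : Convex (diffC G K)
  U-convex = difference-convex G-complex K-subcomplex
  nonempty : ∀ κ {x y} → T (inΛ G K κ (x , y)) → Nonempty x × Nonempty y
  nonempty ΛG  = pair-nonempty {C = nonemptyᵇ} G≠∅ G≠∅
  nonempty ΛK  = pair-nonempty {C = nonemptyᵇ} K≠∅ K≠∅
  nonempty ΛU  = pair-nonempty {C = diffC G K} U≠∅ U≠∅
  nonempty ΛKU = pair-nonempty {C = nonemptyᵇ} K≠∅ U≠∅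
  nonempty ΛUK = pair-nonempty {C = nonemptyᵇ} U≠∅ K≠∅
  nonempty ΛUU = pair-nonempty {C = K} U≠∅ U≠∅
  convex : ∀ κ {x y x₂ y₂ z t} → T (inΛ G K κ (x , y)) → T (inΛ G K κ (x₂ , y₂)) →
    x₂ ⊆ z → z ⊆ x → y₂ ⊆ t → t ⊆ y → T (inΛ G K κ (z , t))
  convex ΛG  = pair-convex G-convex G-convex nonemptyᵇ-convex
  convex ΛK  = pair-convex K-convex K-convex nonemptyᵇ-convex
  convex ΛU  = pair-convex U-convex U-convex U-convex
  convex ΛKU = pair-convex K-convex U-convex nonemptyᵇ-convex
  convex ΛUK = pair-convex U-convex K-convex nonemptyᵇ-convex
  convex ΛUU = pair-convex U-convex U-convex K-convex

mainTheorem4 : (n : ℕ) (G K : Subset n → Bool) →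
    IsComplex G → IsSubcomplex K G → (κ : LambdaKind) →
    (b : ℕ → ℕ) → ((k : ℕ) → IsKerDim (Lblock (Λ G K κ) k) (b k)) →
    altSum (ℕ.suc (2 ℕ.* n)) (fk (Λ G K κ)) ≡ altSum (ℕ.suc (2 ℕ.* n)) b
mainTheorem4 n G K G-complex K-subcomplex κ =
  PairComplex.euler-poincaré-pairs (Λ-convex G K G-complex K-subcomplex κ)
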